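{- Let $M$ be a transversal matroid of rank $r$, and let $\mathcal{A}^i$ be a presentation of $M$ that has rank $i$ in the ordered set of presentations of $M$. If $1\le i<r$, then $$|T_{\mathcal{A}^i}|=|L_{\mathcal{A}^i}|\le\Bigl(\frac12+\frac1{2^{i+1}}\Bigr)2^r,$$ and these bounds are sharp (for each such $r$ and $i$ there exist a rank-$r$ transversal matroid and a presentation of rank $i$ attaining equality). If $i\ge r$, then $|T_{\mathcal{A}^i}|=|L_{\mathcal{A}^i}|\le 2^{r-1}$.
   Context: $[r]=\{1,\dots,r\}$. For a set system $\mathcal{A}=(A_i:i\in[r])$ on a finite set $E$, $M[\mathcal{A}]$ is the transversal matroid on $E$ whose independent sets are the partial transversals of $\mathcal{A}$; $\mathcal{A}$ is a presentation of $M[\mathcal{A}]$; presentations of a rank-$r$ matroid have exactly $r$ sets. Presentations of $M$ are ordered by $(A_i)\preceq(B_i)$ iff $A_i\subseteq B_i$ for all $i$; this ordered set is ranked, the rank of a presentation $(A_i:i\in[r])$ being $r(r-1)-\sum_{i=1}^r r(M\backslash A_i)$ (minimal presentations have rank $0$). Fix $x\notin E$; for $I\subseteq[r]$, $\mathcal{A}^I$ is obtained from $\mathcal{A}$ by replacing $A_i$ by $A_i\cup\{x\}$ for each $i\in I$. Let $\sigma_\mathcal{A}(I)=I\cup\{k\in[r]-I: x\text{ is a coloop of } M[\mathcal{A}^I]\backslash A_k\}$; $L_\mathcal{A}$ is the set of $I\subseteq[r]$ with $\sigma_\mathcal{A}(I)=I$. $T_\mathcal{A}=\{M[\mathcal{A}^I]: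 I\subseteq[r]\}$ is the set of distinct transversal single-element extensions of $M$ obtained by extending $\mathcal{A}$. -}

module Defs where

open import Data.Nat using (ℕ; zero; suc; _+_; _*_; _∸_; _≤_)
open import Data.Bool using (Bool; true; false)
open import Data.Fin using (Fin; zero; suc)
open import Data.Fin.Subset using (Subset; _∈_; _∉_; _⊆_; ∁; ∣_∣)
open import Data.Vec using (Vec; _∷_; lookup; tabulate; sum)
open import Data.List using (List; length)
open import Data.List.Membership.Propositional using () renaming (_∈_ to _∈ˡ_)
open import Data.List.Relation.Unary.Any using (Any)
open import Data.List.Relation.Unary.AllPairs using (AllPairs)
open import Data.List.Relation.Unary.Unique.Propositional using (Unique)
open import Data.Product using (Σ; _×_)
open import Function.Bundles using (_⇔_)
open import Relation.Binary.PropositionalEquality using (_≡_)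
open import Relation.Nullary using (¬_)

SetSystem : ℕ → ℕ → Set
SetSystem r n = Fin r → Subset n

-- A matroid on Fin n, given by its independence predicate on subsets.
-- (Only transversal matroids M[A] occur below.)
IndepPred : ℕ → Set₁
IndepPred n = Subset n → Set

PartialTransversal : ∀ {r n} → SetSystem r n → Subset n → Set
PartialTransversal {r} {n} A X =
  Σ ((e : Fin n) → e ∈ X → Fin r) λ f →
    (∀ e (p : e ∈ X) → e ∈ A (f e p)) ×
    (∀ e e' (p : e ∈ X) (p' : e' ∈ X) → f e p ≡ f e' p' → e ≡ e')

M[_] : ∀ {r n} → SetSystem r n → IndepPred n
M[ A ] = PartialTransversal A

SameMatroid : ∀ {n} → IndepPred n → IndepPred n → Set
SameMatroid M N = ∀ X → M X ⇔ N X

-- B is a basis of the restriction M|Y (equivalently of M \ (E - Y)).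
IsBasisOf : ∀ {n} → IndepPred n → Subset n → Subset n → Set
IsBasisOf M Y B =
  M B × B ⊆ Y × (∀ C → M C → B ⊆ C → C ⊆ Y → C ⊆ B)

RankOf : ∀ {n} → IndepPred n → Subset n → ℕ → Set
RankOf M Y k =
  Σ (Subset _) (λ B → M B × B ⊆ Y × ∣ B ∣ ≡ k) ×
  (∀ C → M C → C ⊆ Y → ∣ C ∣ ≤ k)

IsColoopOf : ∀ {n} → IndepPred n → Subset n → Fin n → Set
IsColoopOf M Y x = x ∈ Y × (∀ B → IsBasisOf M Y B → x ∈ B)

Full : ∀ n → Subset n
Full n = tabulate (λ _ → true)

HasRank : ∀ {n} → IndepPred n → ℕ → Set
HasRank {n} M r = RankOf M (Full n) r

-- Rank of the presentation A of M = M[A] in the ordered set of presentations: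
-- r(r-1) - Σ_j r(M \ A_j)  equals i.
PresentationRank : ∀ {r n} → SetSystem r n → ℕ → Set
PresentationRank {r} A i =
  Σ (Fin r → ℕ) λ ks →
    (∀ j → RankOf M[ A ] (∁ (A j)) (ks j)) ×
    i + sum (tabulate ks) ≡ r * (r ∸ 1)

-- Extension by the new element x, which is  zero : Fin (suc n);
-- e ∈ E is represented by  suc e.  A^I adds x to A_j for j ∈ I.
x₀ : ∀ {n} → Fin (suc n)
x₀ = zero

Ext : ∀ {r n} → SetSystem r n → Subset r → SetSystem r (suc n)
Ext A I j = lookup I j ∷ A j

Lift : ∀ {n} → Subset n → Subset (suc n)
Lift S = false ∷ S

-- I ∈ L_A  iff  σ_A(I) = I, i.e. no k ∉ I has x a coloop of M[A^I] \ A_k.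
InL : ∀ {r n} → SetSystem r n → Subset r → Set
InL A I = ∀ k → k ∉ I → ¬ IsColoopOf M[ Ext A I ] (∁ (Lift (A k))) x₀

CardL : ∀ {r n} → SetSystem r n → ℕ → Set
CardL {r} A m =
  Σ (List (Subset r)) λ Is →
    length Is ≡ m × Unique Is × (∀ I → (I ∈ˡ Is) ⇔ InL A I)

-- |T_A| = m : m index sets whose extensions M[A^I] are pairwise distinct
-- matroids and such that every M[A^I] equals one of them.
CardT : ∀ {r n} → SetSystem r n → ℕ → Set
CardT {r} A m =
  Σ (List (Subset r)) λ Is →
    length Is ≡ m ×
    AllPairs (λ I J → ¬ SameMatroid M[ Ext A I ] M[ Ext A J ]) Is ×
    (∀ I → Any (λ J → SameMatroid M[ Ext A I ] M[ Ext A J ]) Is)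

module Submission where

open import Defs
open import Data.Nat using (ℕ; zero; suc; _+_; _*_; _∸_; _^_; _≤_; _<_; z≤n; s≤s; >-nonZero; _<?_; _≤ᵇ_)
open import Data.Nat.Properties hiding (suc-injective; _≟_)
open import Data.Nat.Tactic.RingSolver using (solve-∀)
open import Data.Bool using (Bool; true; false; not; _∧_; _∨_; T; if_then_else_)
open import Data.Bool.Properties using (∧-zeroʳ; ∧-identityʳ; ∧-conicalˡ; ∧-conicalʳ; ¬-not; not-involutive) renaming (_≟_ to _≟B_)
open import Data.Fin using (Fin; zero; suc; toℕ)
open import Data.Fin.Properties using (any?; all?; suc-injective; ¬∀⟶∃¬) renaming (_≟_ to _≟F_; 0≢1+n to zero≢suc)
open import Data.Fin.Subset using (Subset; _∈_; _⊆_; ∁; ∣_∣; ⁅_⁆; _∩_) renaming (⊥ to ∅)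
open import Data.Fin.Subset.Properties using (anySubset?; _∈?_; _⊆?_; ∣p∣≤n; p⊆q⇒∣p∣≤∣q∣; ∣∁p∣≡n∸∣p∣; ∣p∣≤∣x∷p∣; x∈⁅x⁆; x∈⁅y⁆⇒x≡y; ∣⁅x⁆∣≡1) renaming (∣⊥∣≡0 to ∣∅∣≡0)
open import Data.Vec using (Vec; []; _∷_; lookup; tabulate; sum; tail; _[_]≔_)
open import Data.Vec.Properties using (lookup∘tabulate; lookup-replicate; lookup-map; lookup-zipWith; tabulate-cong; tabulate∘lookup; lookup∘update; lookup∘update′; []=⇒lookup; lookup⇒[]=)
open import Data.Maybe using (Maybe; just; nothing)
open import Data.Maybe.Properties using (just-injective) renaming (≡-dec to ≡-dec-Maybe)
open import Data.List using (List; []; _∷_; length; map; _++_)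
open import Data.List.Properties using (length-++; length-map)
open import Data.List.Membership.Propositional using () renaming (_∈_ to _∈ˡ_)
open import Data.List.Membership.Propositional.Properties using (∈-++⁺ˡ; ∈-++⁺ʳ; ∈-++⁻; ∈-map⁺; ∈-map⁻)
open import Data.List.Relation.Unary.Any using (Any; here; there)
import Data.List.Relation.Unary.Any as Any
import Data.List.Relation.Unary.All as All
open import Data.List.Relation.Unary.AllPairs using (AllPairs; []; _∷_)
open import Data.List.Relation.Unary.Unique.Propositional using (Unique)
import Data.List.Relation.Unary.Unique.Propositional.Properties as Unique
open import Data.Product using (Σ; _×_; _,_; proj₁; proj₂)
open import Data.Sum using (_⊎_; inj₁; inj₂)
open import Data.Empty using (⊥; ⊥-elim)
open import Function using (_∘_)
open import Function.Bundles using (mk⇔; Equivalence)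
open import Relation.Nullary using (¬_; Dec; yes; no; does; ¬?; decidable-stable)
open import Relation.Nullary.Decidable using (_×-dec_; _→-dec_)
open import Relation.Binary.PropositionalEquality using (_≡_; _≢_; refl; sym; trans; cong; cong₂; subst; subst₂; module ≡-Reasoning)

-- Work with matchings (first-order partial transversals) so that
-- independence, bases and coloops of the matroids M[S] are decidable, and
-- prove the augmenting-path exchange property; it gives equicardinality of
-- bases and the fact that a coloop x can be added to any independent set.
-- (1) |T_A| = |L_A|: the σ-step (adding k to I when x is a coloop of
--     M[A^I] \ A_k leaves M[A^I] unchanged) shows that every extension is
--     attained at a fixed point of σ, and distinct fixed points give
--     distinct extensions.
-- (2) Fixed points are closed sets of the digraph D with arcs k → j when x
--     is a coloop of M[A^{j}] \ A_k, and the rank i of A is at most the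
--     number s of arcs of D (an outdegree bound r − 1 ≤ |D_k| + r(M \ A_k)).
-- (3) A loopless digraph with s arcs has at most (1/2 + 1/2^(s+1)) 2^r
--     closed sets; this is decreasing in s, and for s ≥ r at most 2^(r−1).
-- (4) An explicit free presentation attains the bound for 1 ≤ i < r.

∈⇒bit : ∀ {n} {e : Fin n} {p : Subset n} → e ∈ p → lookup p e ≡ true
∈⇒bit = []=⇒lookup

bit⇒∈ : ∀ {n} {e : Fin n} {p : Subset n} → lookup p e ≡ true → e ∈ p
bit⇒∈ {e = e} {p} = lookup⇒[]= e p

true≢false : true ≢ false
true≢false ()

nothing≢just : ∀ {A : Set} {a : A} → nothing ≢ just a
nothing≢just ()

not-true : ∀ {b} → b ≢ true → b ≡ false
not-true = ¬-not

not-false : ∀ {b} → b ≢ false → b ≡ true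
not-false = ¬-not

not-true⇒false : ∀ {b} → not b ≡ true → b ≡ false
not-true⇒false {false} _ = refl

does-true : ∀ {Q : Set} (q : Dec Q) → does q ≡ true → Q
does-true (yes q) _ = q

does-false : ∀ {Q : Set} (q : Dec Q) → does q ≡ false → ¬ Q
does-false (no nq) _ = nq

does-intro : ∀ {Q : Set} (q : Dec Q) → Q → does q ≡ true
does-intro (yes _) _ = refl
does-intro (no nq) q = ⊥-elim (nq q)

infix 4 _⊑_
_⊑_ : ∀ {n} → Subset n → Subset n → Set
p ⊑ q = ∀ e → lookup p e ≡ true → lookup q e ≡ true

⊆⇒⊑ : ∀ {n} {p q : Subset n} → p ⊆ q → p ⊑ q
⊆⇒⊑ h e pe = ∈⇒bit (h (bit⇒∈ pe))

⊑⇒⊆ : ∀ {n} {p q : Subset n} → p ⊑ q → p ⊆ q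
⊑⇒⊆ h {e} pe = bit⇒∈ (h e (∈⇒bit pe))

_⊑?_ : ∀ {n} (p q : Subset n) → Dec (p ⊑ q)
p ⊑? q = all? (λ e → (lookup p e ≟B true) →-dec (lookup q e ≟B true))

subset-ext : ∀ {n} (p q : Subset n) → (∀ e → lookup p e ≡ lookup q e) → p ≡ q
subset-ext p q h = trans (sym (tabulate∘lookup p)) (trans (tabulate-cong h) (tabulate∘lookup q))

lookup-∁ : ∀ {n} (p : Subset n) e → lookup (∁ p) e ≡ not (lookup p e)
lookup-∁ p e = lookup-map e not p

lookup-∩ : ∀ {n} (p q : Subset n) e → lookup (p ∩ q) e ≡ lookup p e ∧ lookup q e
lookup-∩ p q e = lookup-zipWith _∧_ e p q

∁-true : ∀ {n} (p : Subset n) e → lookup (∁ p) e ≡ true → lookup p e ≡ false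
∁-true p e h = not-true⇒false (trans (sym (lookup-∁ p e)) h)

∩-true : ∀ {n} (p q : Subset n) e → lookup (p ∩ q) e ≡ true → lookup p e ≡ true × lookup q e ≡ true
∩-true p q e h = let h' = trans (sym (lookup-∩ p q e)) h in ∧-conicalˡ (lookup p e) _ h' , ∧-conicalʳ _ (lookup q e) h'

∩∁-intro : ∀ {n} (p q : Subset n) e → lookup p e ≡ true → lookup q e ≡ false → lookup (p ∩ ∁ q) e ≡ true
∩∁-intro p q e pe qe = trans (lookup-∩ p (∁ q) e) (cong₂ _∧_ pe (trans (lookup-∁ q e) (cong not qe)))

lookup-∅ : ∀ {n} e → lookup (∅ {n}) e ≡ false
lookup-∅ e = lookup-replicate e false

subsetOf : ∀ {n} {P : Fin n → Set} → (∀ j → Dec (P j)) → Subset n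
subsetOf d = tabulate (λ j → does (d j))

module _ {n} {P : Fin n → Set} (d : ∀ j → Dec (P j)) where

  private
    bit-does : ∀ j → lookup (subsetOf d) j ≡ does (d j)
    bit-does j = lookup∘tabulate (λ j → does (d j)) j

  subsetOf-sound : ∀ j → lookup (subsetOf d) j ≡ true → P j
  subsetOf-sound j h = does-true (d j) (trans (sym (bit-does j)) h)

  subsetOf-false : ∀ j → lookup (subsetOf d) j ≡ false → ¬ P j
  subsetOf-false j h = does-false (d j) (trans (sym (bit-does j)) h)

  subsetOf-complete : ∀ j → P j → lookup (subsetOf d) j ≡ true
  subsetOf-complete j p = trans (bit-does j) (does-intro (d j) p)

card-mono : ∀ {n} (p q : Subset n) → p ⊑ q → ∣ p ∣ ≤ ∣ q ∣
card-mono p q h = p⊆q⇒∣p∣≤∣q∣ {p = p} {q = q} (⊑⇒⊆ h)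

card-ext : ∀ {n} (p q : Subset n) → (∀ e → lookup p e ≡ lookup q e) → ∣ p ∣ ≡ ∣ q ∣
card-ext p q h = cong ∣_∣ (subset-ext p q h)

card-zero : ∀ {n} (p : Subset n) → (∀ e → lookup p e ≢ true) → ∣ p ∣ ≡ 0
card-zero [] h = refl
card-zero (true ∷ p) h = ⊥-elim (h zero refl)
card-zero (false ∷ p) h = card-zero p (λ e → h (suc e))

card-pos : ∀ {n} (p : Subset n) e → lookup p e ≡ true → 1 ≤ ∣ p ∣
card-pos (true ∷ p) zero _ = s≤s z≤n
card-pos (b ∷ p) (suc e) h = ≤-trans (card-pos p e h) (∣p∣≤∣x∷p∣ b p)

card-add1 : ∀ {n} (p q : Subset n) (e : Fin n) → lookup p e ≡ false → lookup q e ≡ true →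
  (∀ e' → e' ≢ e → lookup q e' ≡ lookup p e') → ∣ q ∣ ≡ suc ∣ p ∣
card-add1 (a ∷ p) (b ∷ q) zero refl refl h = cong suc (card-ext q p (λ i → h (suc i) (λ ())))
card-add1 (a ∷ p) (b ∷ q) (suc e) pe qe h with h zero (λ ())
... | refl = cons a (card-add1 p q e pe qe (λ e' ne → h (suc e') (ne ∘ suc-injective)))
  where
  cons : ∀ a → ∣ q ∣ ≡ suc ∣ p ∣ → ∣ a ∷ q ∣ ≡ suc ∣ a ∷ p ∣
  cons true eq = cong suc eq
  cons false eq = eq

∣Full∣ : ∀ n → ∣ Full n ∣ ≡ n
∣Full∣ zero = refl
∣Full∣ (suc n) = cong suc (∣Full∣ n)

card-as-sum : ∀ {r} (b : Fin r → Bool) → ∣ tabulate b ∣ ≡ sum (tabulate (λ k → if b k then 1 else 0))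
card-as-sum {zero} b = refl
card-as-sum {suc r} b with b zero
... | true = cong suc (card-as-sum (b ∘ suc))
... | false = card-as-sum (b ∘ suc)

-- Inserting and removing a single element; kept abstract so that only the
-- two lookup laws of each are used.
abstract
  insert : ∀ {n} → Subset n → Fin n → Subset n
  insert q e = q [ e ]≔ true

  remove : ∀ {n} → Subset n → Fin n → Subset n
  remove q e = q [ e ]≔ false

  insert-at : ∀ {n} (q : Subset n) e → lookup (insert q e) e ≡ true
  insert-at q e = lookup∘update e q true

  insert-other : ∀ {n} (q : Subset n) e e' → e' ≢ e → lookup (insert q e) e' ≡ lookup q e'
  insert-other q e e' ne = lookup∘update′ ne q true

  remove-at : ∀ {n} (q : Subset n) e → lookup (remove q e) e ≡ false
  remove-at q e = lookup∘update e q false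

  remove-other : ∀ {n} (q : Subset n) e e' → e' ≢ e → lookup (remove q e) e' ≡ lookup q e'
  remove-other q e e' ne = lookup∘update′ ne q false

insert-mem : ∀ {n} (q : Subset n) e e' → lookup (insert q e) e' ≡ true → e' ≡ e ⊎ lookup q e' ≡ true
insert-mem q e e' h with e' ≟F e
... | yes eq = inj₁ eq
... | no ne = inj₂ (trans (sym (insert-other q e e' ne)) h)

remove-mem : ∀ {n} (q : Subset n) e e' → lookup (remove q e) e' ≡ true → e' ≢ e × lookup q e' ≡ true
remove-mem q e e' h with e' ≟F e
... | yes refl = ⊥-elim (true≢false (trans (sym h) (remove-at q e)))
... | no ne = ne , trans (sym (remove-other q e e' ne)) h

⊑-insert : ∀ {n} (q : Subset n) e → q ⊑ insert q e
⊑-insert q e e' qe' with e' ≟F e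
... | yes refl = insert-at q e
... | no ne = trans (insert-other q e e' ne) qe'

insert-⊑ : ∀ {n} (q p : Subset n) e → lookup p e ≡ true → q ⊑ p → insert q e ⊑ p
insert-⊑ q p e pe qp e' h with insert-mem q e e' h
... | inj₁ refl = pe
... | inj₂ qe' = qp e' qe'

card-insert : ∀ {n} (q : Subset n) e → lookup q e ≡ false → ∣ insert q e ∣ ≡ suc ∣ q ∣
card-insert q e qe = card-add1 q (insert q e) e qe (insert-at q e) (insert-other q e)

card-remove : ∀ {n} (q : Subset n) e → lookup q e ≡ true → ∣ q ∣ ≡ suc ∣ remove q e ∣
card-remove q e qe = card-add1 (remove q e) q e (remove-at q e) qe (λ e' ne → sym (remove-other q e e' ne))

card-insert≤ : ∀ {n} (q : Subset n) e → ∣ insert q e ∣ ≤ suc ∣ q ∣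
card-insert≤ q e with lookup q e in qe
... | false = ≤-reflexive (card-insert q e qe)
... | true = ≤-trans (≤-reflexive (card-ext (insert q e) q same)) (n≤1+n _)
  where
  same : ∀ e' → lookup (insert q e) e' ≡ lookup q e'
  same e' with e' ≟F e
  ... | yes refl = trans (insert-at q e) (sym qe)
  ... | no ne = insert-other q e e' ne

card-remove≤ : ∀ {n} (q : Subset n) e → ∣ q ∣ ≤ suc ∣ remove q e ∣
card-remove≤ q e with lookup q e in qe
... | true = ≤-reflexive (card-remove q e qe)
... | false = ≤-trans (≤-reflexive (card-ext q (remove q e) same)) (n≤1+n _)
  where
  same : ∀ e' → lookup q e' ≡ lookup (remove q e) e'
  same e' with e' ≟F e
  ... | yes refl = trans qe (sym (remove-at q e))
  ... | no ne = sym (remove-other q e e' ne)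

card-insert-two : ∀ {n} (p : Subset n) a b → lookup p a ≡ false → lookup p b ≡ false → a ≢ b →
  ∣ insert (insert p a) b ∣ ≡ 2 + ∣ p ∣
card-insert-two p a b pa pb a≢b =
  trans (card-insert (insert p a) b (trans (insert-other p a b (a≢b ∘ sym)) pb)) (cong suc (card-insert p a pa))


card-∁-insert : ∀ {n} (q : Subset n) e → lookup q e ≡ false → ∣ ∁ q ∣ ≡ suc ∣ ∁ (insert q e) ∣
card-∁-insert q e qe = card-add1 (∁ (insert q e)) (∁ q) e
  (trans (lookup-∁ (insert q e) e) (cong not (insert-at q e)))
  (trans (lookup-∁ q e) (cong not qe))
  (λ e' ne → trans (lookup-∁ q e') (trans (cong not (sym (insert-other q e e' ne))) (sym (lookup-∁ (insert q e) e'))))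

card≤remove+bit : ∀ {n} (q : Subset n) v → ∣ q ∣ ≤ ∣ remove q v ∣ + (if lookup q v then 1 else 0)
card≤remove+bit q v with lookup q v in qv
... | true = ≤-reflexive (trans (card-remove q v qv) (+-comm 1 _))
... | false = ≤-trans (≤-reflexive (card-ext q (remove q v) same)) (m≤m+n _ 0)
  where
  same : ∀ e → lookup q e ≡ lookup (remove q v) e
  same e with e ≟F v
  ... | yes refl = trans qv (sym (remove-at q v))
  ... | no ne = sym (remove-other q v e ne)

card-image : ∀ {n r} (p : Subset n) (U : Subset r) (F : Fin n → Maybe (Fin r)) →
  (∀ j → lookup U j ≡ true → Σ (Fin n) λ e → lookup p e ≡ true × F e ≡ just j) → ∣ U ∣ ≤ ∣ p ∣
card-image [] U F h = ≤-reflexive (card-zero U (λ j u → no-preimage (h j u)))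
  where
  no-preimage : ∀ {B : Fin 0 → Set} → Σ (Fin 0) B → ⊥
  no-preimage (() , _)
card-image (false ∷ p) U F h = card-image p U (F ∘ suc) preimage
  where
  preimage : ∀ j → lookup U j ≡ true → Σ _ λ e → lookup p e ≡ true × F (suc e) ≡ just j
  preimage j u with h j u
  ... | suc e , pe , Fe = e , pe , Fe
card-image (true ∷ p) U F h with F zero in F0
... | nothing = ≤-trans (card-image p U (F ∘ suc) preimage) (n≤1+n _)
  where
  preimage : ∀ j → lookup U j ≡ true → Σ _ λ e → lookup p e ≡ true × F (suc e) ≡ just j
  preimage j u with h j u
  ... | zero , _ , Fe = ⊥-elim (nothing≢just (trans (sym F0) Fe))
  ... | suc e , pe , Fe = e , pe , Fe
... | just j0 = ≤-trans (card-remove≤ U j0) (s≤s (card-image p (remove U j0) (F ∘ suc) preimage))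
  where
  preimage : ∀ j → lookup (remove U j0) j ≡ true → Σ _ λ e → lookup p e ≡ true × F (suc e) ≡ just j
  preimage j u with remove-mem U j0 j u
  ... | j≢j0 , Uj with h j Uj
  ...   | zero , _ , Fe = ⊥-elim (j≢j0 (just-injective (trans (sym Fe) F0)))
  ...   | suc e , pe , Fe = e , pe , Fe

sum-+ : ∀ {r} (f g : Fin r → ℕ) → sum (tabulate (λ k → f k + g k)) ≡ sum (tabulate f) + sum (tabulate g)
sum-+ {zero} f g = refl
sum-+ {suc r} f g = trans (cong (f zero + g zero +_) (sum-+ (f ∘ suc) (g ∘ suc)))
                          (interchange (f zero) (g zero) (sum (tabulate (f ∘ suc))) (sum (tabulate (g ∘ suc))))
  where
  interchange : ∀ a b c d → a + b + (c + d) ≡ a + c + (b + d)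
  interchange = solve-∀

sum-mono : ∀ {r} (f g : Fin r → ℕ) → (∀ k → f k ≤ g k) → sum (tabulate f) ≤ sum (tabulate g)
sum-mono {zero} f g h = z≤n
sum-mono {suc r} f g h = +-mono-≤ (h zero) (sum-mono (f ∘ suc) (g ∘ suc) (h ∘ suc))

sum-const : ∀ r c → sum (tabulate {n = r} (λ _ → c)) ≡ r * c
sum-const zero c = refl
sum-const (suc r) c = cong (c +_) (sum-const r c)

sum-zero : ∀ {r} (f : Fin r → ℕ) → (∀ k → f k ≡ 0) → sum (tabulate f) ≡ 0
sum-zero {zero} f h = refl
sum-zero {suc r} f h = cong₂ _+_ (h zero) (sum-zero (f ∘ suc) (h ∘ suc))

sum-ext : ∀ {r} (f g : Fin r → ℕ) → (∀ k → f k ≡ g k) → sum (tabulate f) ≡ sum (tabulate g)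
sum-ext f g h = cong sum (tabulate-cong h)

-- A partial transversal of S on X is represented by a partial
-- map m from elements to set indices that is a matching of S (each matched
-- element lies in its set, distinct elements get distinct sets) and covers
-- X.  This first-order form is decidable and easy to modify locally.

Matching : ℕ → ℕ → Set
Matching r N = Fin N → Maybe (Fin r)

IsMatching : ∀ {r N} → SetSystem r N → Matching r N → Set
IsMatching S m = (∀ e j → m e ≡ just j → lookup (S j) e ≡ true) ×
                 (∀ e e' j → m e ≡ just j → m e' ≡ just j → e ≡ e')

Covers : ∀ {r N} → Matching r N → Subset N → Set
Covers {r} m X = ∀ e → lookup X e ≡ true → Σ (Fin r) λ j → m e ≡ just j

Indep : ∀ {r N} → SetSystem r N → Subset N → Set
Indep S X = Σ _ λ m → IsMatching S m × Covers m X

assign : ∀ {r N} → Matching r N → Fin N → Maybe (Fin r) → Matching r N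
assign m e v e' = if does (e' ≟F e) then v else m e'

assign-at : ∀ {r N} (m : Matching r N) e v → assign m e v e ≡ v
assign-at m e v with e ≟F e
... | yes _ = refl
... | no ne = ⊥-elim (ne refl)

assign-other : ∀ {r N} (m : Matching r N) e v e' → e' ≢ e → assign m e v e' ≡ m e'
assign-other m e v e' ne with e' ≟F e
... | yes eq = ⊥-elim (ne eq)
... | no _ = refl

restrict : ∀ {r N} → Matching r N → Subset N → Matching r N
restrict m W e = if lookup W e then m e else nothing

restrict-just : ∀ {r N} (m : Matching r N) W e j → restrict m W e ≡ just j → lookup W e ≡ true × m e ≡ just j
restrict-just m W e j eq with lookup W e
... | true = refl , eq
... | false = ⊥-elim (nothing≢just eq)

restrict-in : ∀ {r N} (m : Matching r N) W e → lookup W e ≡ true → restrict m W e ≡ m e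
restrict-in m W e h with lookup W e
... | true = refl
... | false = ⊥-elim (true≢false (sym h))

restrict-matching : ∀ {r N} {S : SetSystem r N} {m} W → IsMatching S m → IsMatching S (restrict m W)
restrict-matching {m = m} W (mem , inj) = (λ e j eq → mem e j (proj₂ (restrict-just m W e j eq))) ,
  (λ e e' j a b → inj e e' j (proj₂ (restrict-just m W e j a)) (proj₂ (restrict-just m W e' j b)))

restrict-covers : ∀ {r N} (m : Matching r N) W → Covers m W → Covers (restrict m W) W
restrict-covers m W cov e we with lookup W e in eq
... | true = cov e eq
... | false = ⊥-elim (true≢false (sym we))

Indep-⊑ : ∀ {r N} (S : SetSystem r N) (X X' : Subset N) → X ⊑ X' → Indep S X' → Indep S X
Indep-⊑ S X X' sub (m , v , c) = m , v , (λ e xe → c e (sub e xe))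

Indep-weaken : ∀ {r N} (S S' : SetSystem r N) → (∀ j → S j ⊑ S' j) → ∀ X → Indep S X → Indep S' X
Indep-weaken S S' h X (m , (mem , inj) , c) = m , ((λ e j eq → h j e (mem e j eq)) , inj) , c

module MatchingsOf {r N : ℕ} (S : SetSystem r N) where

  Indep⇒PT : ∀ {X} → Indep S X → PartialTransversal S X
  Indep⇒PT {X} (m , (mem , inj) , cov) = f , memf , injf
    where
    f : (e : Fin N) → e ∈ X → Fin r
    f e p = proj₁ (cov e (∈⇒bit p))
    memf : ∀ e p → e ∈ S (f e p)
    memf e p = bit⇒∈ (mem e (f e p) (proj₂ (cov e (∈⇒bit p))))
    injf : ∀ e e' p p' → f e p ≡ f e' p' → e ≡ e'
    injf e e' p p' eq = inj e e' (f e p) (proj₂ (cov e (∈⇒bit p)))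
                          (trans (proj₂ (cov e' (∈⇒bit p'))) (cong just (sym eq)))

  PT⇒Indep : ∀ {X} → PartialTransversal S X → Indep S X
  PT⇒Indep {X} (f , memf , injf) = g , (gmem , ginj) , gcov
    where
    g : Matching r N
    g e with e ∈? X
    ... | yes p = just (f e p)
    ... | no _ = nothing
    g-just : ∀ e j → g e ≡ just j → Σ (e ∈ X) λ p → f e p ≡ j
    g-just e j eq with e ∈? X
    g-just e j refl | yes p = p , refl
    g-just e j () | no _
    gmem : ∀ e j → g e ≡ just j → lookup (S j) e ≡ true
    gmem e j eq with g-just e j eq
    ... | p , refl = ∈⇒bit (memf e p)
    ginj : ∀ e e' j → g e ≡ just j → g e' ≡ just j → e ≡ e'
    ginj e e' j a b with g-just e j a | g-just e' j b
    ... | p , fp | p' , fp' = injf e e' p p' (trans fp (sym fp'))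
    gcov : Covers g X
    gcov e xe with e ∈? X
    ... | yes p = f e p , refl
    ... | no np = ⊥-elim (np (bit⇒∈ xe))

  -- Independence is decidable: a matching is a vector of  Maybe (Fin r)
  -- of length N, and there are finitely many.
  private
    exists-Maybe? : (Q : Maybe (Fin r) → Set) → (∀ a → Dec (Q a)) → Dec (Σ _ Q)
    exists-Maybe? Q d with d nothing
    ... | yes q = yes (nothing , q)
    ... | no nq with any? (λ j → d (just j))
    ... | yes (j , q) = yes (just j , q)
    ... | no nq' = no λ { (nothing , q) → nq q ; (just j , q) → nq' (j , q) }

    exists-vector? : ∀ K (P : Vec (Maybe (Fin r)) K → Set) → (∀ v → Dec (P v)) → Dec (Σ _ P)
    exists-vector? zero P d with d []
    ... | yes p = yes ([] , p)
    ... | no np = no λ { ([] , p) → np p }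
    exists-vector? (suc K) P d
      with exists-Maybe? (λ a → Σ _ λ v → P (a ∷ v)) (λ a → exists-vector? K (λ v → P (a ∷ v)) (λ v → d (a ∷ v)))
    ... | yes (a , v , p) = yes (a ∷ v , p)
    ... | no np = no λ { (a ∷ v , p) → np (a , v , p) }

    IsMatching? : ∀ m → Dec (IsMatching S m)
    IsMatching? m =
      all? (λ e → all? (λ j → ≡-dec-Maybe _≟F_ (m e) (just j) →-dec (lookup (S j) e ≟B true)))
      ×-dec all? (λ e → all? (λ e' → all? (λ j →
              ≡-dec-Maybe _≟F_ (m e) (just j) →-dec (≡-dec-Maybe _≟F_ (m e') (just j) →-dec (e ≟F e')))))

    Covers? : ∀ (m : Matching r N) X → Dec (Covers m X)
    Covers? m X = all? (λ e → (lookup X e ≟B true) →-dec any? (λ j → ≡-dec-Maybe _≟F_ (m e) (just j)))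

  Indep? : ∀ X → Dec (Indep S X)
  Indep? X with exists-vector? N (λ v → IsMatching S (lookup v) × Covers (lookup v) X)
                  (λ v → IsMatching? (lookup v) ×-dec Covers? (lookup v) X)
  ... | yes (v , vM , vC) = yes (lookup v , vM , vC)
  ... | no nv = no λ { (m , (mem , inj) , cov) → nv (tabulate m ,
          ((λ e j eq → mem e j (trans (sym (lookup∘tabulate m e)) eq)) ,
           (λ e e' j a b → inj e e' j (trans (sym (lookup∘tabulate m e)) a) (trans (sym (lookup∘tabulate m e')) b))) ,
          (λ e xe → let (j , eq) = cov e xe in j , trans (lookup∘tabulate m e) eq)) }

  PartialTransversal? : ∀ X → Dec (PartialTransversal S X)
  PartialTransversal? X with Indep? X
  ... | yes i = yes (Indep⇒PT i)
  ... | no ni = no (ni ∘ PT⇒Indep)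

open MatchingsOf

-- Walking the alternating path that starts at
-- e0 and repeatedly hands an element its g-partner, we find that either
-- Z + e0 is independent, or some z ∈ Z left unmatched by g can be exchanged
-- for e0.  This exchange property yields that all bases of a restriction
-- have the same size (equicardinality below).
module Augmenting {r N : ℕ} (S : SetSystem r N) (g : Matching r N) (g-matching : IsMatching S g)
                  (Z : Subset N) (e0 : Fin N) (j0 : Fin r) (g-e0 : g e0 ≡ just j0) where

  Z⁺ : Subset N
  Z⁺ = insert Z e0

  Outcome : Set
  Outcome = Indep S Z⁺ ⊎
            Σ (Fin N) λ z → lookup Z z ≡ true × g z ≡ nothing × Indep S (insert (remove Z z) e0)

  agree : Maybe (Fin r) → Maybe (Fin r) → Bool
  agree (just a) (just b) = does (a ≟F b)
  agree _ _ = false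

  agree-sound : ∀ x y → agree x y ≡ true → Σ _ λ a → x ≡ just a × y ≡ just a
  agree-sound (just a) (just b) t with a ≟F b
  ... | yes refl = a , refl , refl
  agree-sound (just a) (just b) () | no _
  agree-sound (just a) nothing ()
  agree-sound nothing y ()

  agree-refl : ∀ a → agree (just a) (just a) ≡ true
  agree-refl a with a ≟F a
  ... | yes _ = refl
  ... | no ne = ⊥-elim (ne refl)

  -- The elements on which h agrees with g; it grows along the path,
  -- which bounds the length of the walk by N.
  agreement : Matching r N → Subset N
  agreement h = tabulate (λ e → agree (h e) (g e))

  agreement-at : ∀ h e → lookup (agreement h) e ≡ agree (h e) (g e)
  agreement-at h e = lookup∘tabulate (λ e → agree (h e) (g e)) e

  -- A stage of the walk: h covers Z⁺ except the current element c, which is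
  -- unmatched in h and should receive its g-partner jc.
  record Stage : Set where
    field
      h : Matching r N
      c : Fin N
      jc : Fin r
      h-matching : IsMatching S h
      h-covers : ∀ e → lookup Z⁺ e ≡ true → e ≢ c → Σ _ λ j → h e ≡ just j
      h-c : h c ≡ nothing
      g-c : g c ≡ just jc
      c∈Z⁺ : lookup Z⁺ c ≡ true

  module _ (P : Stage) where
    open Stage P

    -- If no element uses jc, give it to c: Z⁺ becomes independent.
    finish : (∀ w → h w ≢ just jc) → Indep S Z⁺
    finish free = h' , (mem' , inj') , cov'
      where
      h' : Matching r N
      h' = assign h c (just jc)
      mem' : ∀ e j → h' e ≡ just j → lookup (S j) e ≡ true
      mem' e j eq with e ≟F c
      ... | yes refl = subst (λ j → lookup (S j) c ≡ true) (just-injective eq) (proj₁ g-matching c jc g-c)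
      ... | no ne = proj₁ h-matching e j eq
      inj' : ∀ e e' j → h' e ≡ just j → h' e' ≡ just j → e ≡ e'
      inj' e e' j a b with e ≟F c | e' ≟F c
      ... | yes p | yes q = trans p (sym q)
      ... | yes p | no q = ⊥-elim (free e' (trans b (cong just (sym (just-injective a)))))
      ... | no p | yes q = ⊥-elim (free e (trans a (cong just (sym (just-injective b)))))
      ... | no p | no q = proj₂ h-matching e e' j a b
      cov' : Covers h' Z⁺
      cov' e ze with e ≟F c
      ... | yes _ = jc , refl
      ... | no ne = h-covers e ze ne

    -- Otherwise w holds jc: move jc from w to c.  The new matching covers
    -- Z⁺ except w, and agrees with g on one more element.
    module Reassign (w : Fin N) (h-w : h w ≡ just jc) where

      w≢c : w ≢ c
      w≢c refl = nothing≢just (trans (sym h-c) h-w)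

      h₁ : Matching r N
      h₁ = assign (assign h w nothing) c (just jc)

      h₁-c : h₁ c ≡ just jc
      h₁-c = assign-at (assign h w nothing) c (just jc)

      h₁-w : h₁ w ≡ nothing
      h₁-w = trans (assign-other (assign h w nothing) c (just jc) w w≢c) (assign-at h w nothing)

      h₁-other : ∀ e → e ≢ c → e ≢ w → h₁ e ≡ h e
      h₁-other e nc nw = trans (assign-other (assign h w nothing) c (just jc) e nc) (assign-other h w nothing e nw)

      h₁-just : ∀ e j → h₁ e ≡ just j → (e ≡ c × j ≡ jc) ⊎ (e ≢ c × e ≢ w × h e ≡ just j)
      h₁-just e j eq = cases (e ≟F c) (e ≟F w)
        where
        cases : Dec (e ≡ c) → Dec (e ≡ w) → (e ≡ c × j ≡ jc) ⊎ (e ≢ c × e ≢ w × h e ≡ just j)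
        cases (yes refl) _ = inj₁ (refl , sym (just-injective (trans (sym h₁-c) eq)))
        cases (no nc) (yes refl) = ⊥-elim (nothing≢just (trans (sym h₁-w) eq))
        cases (no nc) (no nw) = inj₂ (nc , nw , trans (sym (h₁-other e nc nw)) eq)

      h₁-matching : IsMatching S h₁
      h₁-matching = mem₁ , inj₁'
        where
        mem₁ : ∀ e j → h₁ e ≡ just j → lookup (S j) e ≡ true
        mem₁ e j eq with h₁-just e j eq
        ... | inj₁ (refl , refl) = proj₁ g-matching c jc g-c
        ... | inj₂ (_ , _ , he) = proj₁ h-matching e j he
        inj₁' : ∀ e e' j → h₁ e ≡ just j → h₁ e' ≡ just j → e ≡ e'
        inj₁' e e' j a b with h₁-just e j a | h₁-just e' j b
        ... | inj₁ (p , _) | inj₁ (q , _) = trans p (sym q)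
        ... | inj₁ (_ , refl) | inj₂ (_ , nw , he') = ⊥-elim (nw (proj₂ h-matching e' w jc he' h-w))
        ... | inj₂ (_ , nw , he) | inj₁ (_ , refl) = ⊥-elim (nw (proj₂ h-matching e w jc he h-w))
        ... | inj₂ (_ , _ , he) | inj₂ (_ , _ , he') = proj₂ h-matching e e' j he he'

      h₁-covers : ∀ e → lookup Z⁺ e ≡ true → e ≢ w → Σ _ λ j → h₁ e ≡ just j
      h₁-covers e ze nw = cases (e ≟F c)
        where
        cases : Dec (e ≡ c) → Σ _ λ j → h₁ e ≡ just j
        cases (yes refl) = jc , h₁-c
        cases (no nc) = let (j , he) = h-covers e ze nc in j , trans (h₁-other e nc nw) he

      agreement-grows : suc ∣ agreement h ∣ ≤ ∣ agreement h₁ ∣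
      agreement-grows =
        subst (_≤ ∣ agreement h₁ ∣)
              (card-insert (agreement h) c (trans (agreement-at h c) (cong (λ x → agree x (g c)) h-c)))
              (card-mono (insert (agreement h) c) (agreement h₁) (insert-⊑ (agreement h) (agreement h₁) c at-c kept))
        where
        at-c : lookup (agreement h₁) c ≡ true
        at-c = trans (agreement-at h₁ c) (subst₂ (λ x y → agree x y ≡ true) (sym h₁-c) (sym g-c) (agree-refl jc))
        kept : agreement h ⊑ agreement h₁
        kept e ae with agree-sound (h e) (g e) (trans (sym (agreement-at h e)) ae) | e ≟F c | e ≟F w
        ... | a , ha , ga | yes refl | _ = ⊥-elim (nothing≢just (trans (sym h-c) ha))
        ... | a , ha , ga | no nc | yes refl with trans (sym h-w) ha
        ... | refl = ⊥-elim (nc (proj₂ g-matching w c jc ga g-c))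
        kept e ae | _ | no nc | no nw =
          trans (agreement-at h₁ e) (trans (cong (λ x → agree x (g e)) (h₁-other e nc nw)) (trans (sym (agreement-at h e)) ae))

    step : Outcome ⊎ Σ Stage λ P' → suc ∣ agreement h ∣ ≤ ∣ agreement (Stage.h P') ∣
    step with any? (λ w → ≡-dec-Maybe _≟F_ (h w) (just jc))
    ... | no used = inj₁ (inj₁ (finish (λ w hw → used (w , hw))))
    ... | yes (w , h-w) = continue
      where
      open Reassign w h-w
      continue : Outcome ⊎ Σ Stage λ P' → suc ∣ agreement h ∣ ≤ ∣ agreement (Stage.h P') ∣
      continue with g w in g-w | lookup Z⁺ w in w-Z⁺
      ... | _ | false = inj₁ (inj₁ (h₁ , h₁-matching , λ e ze → h₁-covers e ze λ { refl → true≢false (trans (sym ze) w-Z⁺) }))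
      ... | just jw | true = inj₂ (record { h = h₁ ; c = w ; jc = jw ; h-matching = h₁-matching ; h-covers = h₁-covers
                                          ; h-c = h₁-w ; g-c = g-w ; c∈Z⁺ = w-Z⁺ } , agreement-grows)
      ... | nothing | true with insert-mem Z e0 w w-Z⁺
      ...   | inj₁ refl = ⊥-elim (nothing≢just (trans (sym g-w) g-e0))
      ...   | inj₂ w∈Z = inj₁ (inj₂ (w , w∈Z , g-w , h₁ , h₁-matching , cover))
        where
        cover : Covers h₁ (insert (remove Z w) e0)
        cover e ze with insert-mem (remove Z w) e0 e ze
        ... | inj₁ refl = h₁-covers e0 (insert-at Z e0) λ { refl → nothing≢just (trans (sym g-w) g-e0) }
        ... | inj₂ re with remove-mem Z w e re
        ... | nw , zz = h₁-covers e (⊑-insert Z e0 e zz) nw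

  -- The walk ends within N steps, since agreements have at most N elements.
  walk : (k : ℕ) (P : Stage) → N ≤ ∣ agreement (Stage.h P) ∣ + k → Outcome
  walk k P bound with step P
  ... | inj₁ done = done
  ... | inj₂ (P' , grows) with k
  ...   | zero = ⊥-elim (<⇒≱ (≤-trans (s≤s (≤-trans bound (≤-reflexive (+-identityʳ _)))) grows)
                                (∣p∣≤n (agreement (Stage.h P'))))
  ...   | suc k' = walk k' P' (≤-trans bound (≤-trans (≤-reflexive (+-suc _ k')) (+-monoˡ-≤ k' grows)))

  augment : Indep S Z → lookup Z e0 ≡ false → Outcome
  augment (h , h-matching , h-covers) Z-e0 = walk N start (m≤n+m N _)
    where
    h₀ : Matching r N
    h₀ = assign h e0 nothing
    h₀-other : ∀ e j → h₀ e ≡ just j → h e ≡ just j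
    h₀-other e j eq = cases (e ≟F e0)
      where
      cases : Dec (e ≡ e0) → h e ≡ just j
      cases (yes refl) = ⊥-elim (nothing≢just (trans (sym (assign-at h e0 nothing)) eq))
      cases (no ne) = trans (sym (assign-other h e0 nothing e ne)) eq
    start : Stage
    start = record
      { h = h₀ ; c = e0 ; jc = j0
      ; h-matching = (λ e j eq → proj₁ h-matching e j (h₀-other e j eq)) ,
                     (λ e e' j a b → proj₂ h-matching e e' j (h₀-other e j a) (h₀-other e' j b))
      ; h-covers = λ e ze ne → let (j , he) = h-covers e (trans (sym (insert-other Z e0 e ne)) ze)
                                in j , trans (assign-other h e0 nothing e ne) he
      ; h-c = assign-at h e0 nothing ; g-c = g-e0 ; c∈Z⁺ = insert-at Z e0 }

module BasesOf {r N : ℕ} (S : SetSystem r N) where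

  Basis : Subset N → Subset N → Set
  Basis Y B = Indep S B × B ⊑ Y × (∀ C → Indep S C → B ⊑ C → C ⊑ Y → C ⊑ B)

  Basis⇒IsBasisOf : ∀ {Y B} → Basis Y B → IsBasisOf M[ S ] Y B
  Basis⇒IsBasisOf (iB , BY , mx) =
    Indep⇒PT S iB , ⊑⇒⊆ BY , (λ C pC BC CY → ⊑⇒⊆ (mx C (PT⇒Indep S pC) (⊆⇒⊑ BC) (⊆⇒⊑ CY)))

  IsBasisOf⇒Basis : ∀ {Y B} → IsBasisOf M[ S ] Y B → Basis Y B
  IsBasisOf⇒Basis (pB , BY , mx) =
    PT⇒Indep S pB , ⊆⇒⊑ BY , (λ C iC BC CY → ⊆⇒⊑ (mx C (Indep⇒PT S iC) (⊑⇒⊆ BC) (⊑⇒⊆ CY)))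

  private
    allSubsets? : ∀ {P : Subset N → Set} → (∀ C → Dec (P C)) → Dec (∀ C → P C)
    allSubsets? d with anySubset? (λ C → ¬? (d C))
    ... | yes (C , np) = no λ h → np (h C)
    ... | no h = yes λ C → decidable-stable (d C) (λ np → h (C , np))

  IsBasisOf? : ∀ Y B → Dec (IsBasisOf M[ S ] Y B)
  IsBasisOf? Y B = PartialTransversal? S B ×-dec (B ⊆? Y) ×-dec
    allSubsets? (λ C → PartialTransversal? S C →-dec ((B ⊆? C) →-dec ((C ⊆? Y) →-dec (C ⊆? B))))

  IsColoopOf? : ∀ Y x → Dec (IsColoopOf M[ S ] Y x)
  IsColoopOf? Y x = (x ∈? Y) ×-dec allSubsets? (λ B → IsBasisOf? Y B →-dec (x ∈? B))

  -- Every independent X ⊑ Y extends to a basis of Y: while a strictly larger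
  -- independent C ⊑ Y exists, pass to it (at most N times).
  extend : ∀ (Y X : Subset N) → Indep S X → X ⊑ Y → Σ (Subset N) λ B → Basis Y B × X ⊑ B
  extend Y X iX XY = grow N X iX XY (m≤n+m N _) (λ e h → h)
    where
    grow : (k : ℕ) (X' : Subset N) → Indep S X' → X' ⊑ Y → N ≤ ∣ X' ∣ + k → X ⊑ X' →
           Σ (Subset N) λ B → Basis Y B × X ⊑ B
    grow k X' iX' X'Y bound XX'
      with anySubset? (λ C → Indep? S C ×-dec X' ⊑? C ×-dec C ⊑? Y ×-dec ¬? (C ⊑? X'))
    ... | no none = X' , (iX' , X'Y , λ C iC X'C CY → decidable-stable (C ⊑? X') (λ n → none (C , iC , X'C , CY , n))) , XX'
    ... | yes (C , iC , X'C , CY , C⋢X') with ¬∀⟶∃¬ N _ (λ e → (lookup C e ≟B true) →-dec (lookup X' e ≟B true)) C⋢X'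
    ...   | e , ne = continue k bound
      where
      larger : suc ∣ X' ∣ ≤ ∣ C ∣
      larger = subst (_≤ ∣ C ∣) (card-insert X' e (not-true λ x → ne λ _ → x))
                     (card-mono (insert X' e) C
                        (insert-⊑ X' C e (not-false λ c → ne λ ce → ⊥-elim (true≢false (trans (sym ce) c))) X'C))
      continue : (k : ℕ) → N ≤ ∣ X' ∣ + k → Σ (Subset N) λ B → Basis Y B × X ⊑ B
      continue zero b = ⊥-elim (<⇒≱ (≤-trans (s≤s (≤-trans b (≤-reflexive (+-identityʳ _)))) larger) (∣p∣≤n C))
      continue (suc k) b = grow k C iC CY (≤-trans b (≤-trans (≤-reflexive (+-suc _ k)) (+-monoˡ-≤ k larger)))
                                (λ e' h → X'C e' (XX' e' h))

  _∖_ : Subset N → Subset N → Subset N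
  Z ∖ B = tabulate (λ e → lookup Z e ∧ not (lookup B e))

  lookup-∖ : ∀ Z B e → lookup (Z ∖ B) e ≡ lookup Z e ∧ not (lookup B e)
  lookup-∖ Z B e = lookup∘tabulate (λ e → lookup Z e ∧ not (lookup B e)) e

  exchange-sizes : ∀ (B Z Z* : Subset N) a b → lookup Z a ≡ true → lookup B a ≡ false → lookup Z b ≡ false →
    lookup B b ≡ true → lookup Z* a ≡ false → lookup Z* b ≡ true →
    (∀ e → e ≢ a → e ≢ b → lookup Z* e ≡ lookup Z e) →
    ∣ Z* ∣ ≡ ∣ Z ∣ × suc ∣ Z* ∖ B ∣ ≡ ∣ Z ∖ B ∣
  exchange-sizes B Z Z* a b Za Ba Zb Bb Z*a Z*b others = same-size , closer
    where
    a≢b : a ≢ b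
    a≢b refl = true≢false (trans (sym Bb) Ba)
    Z₋ : Subset N
    Z₋ = remove Z a
    same-size : ∣ Z* ∣ ≡ ∣ Z ∣
    same-size = trans (card-add1 Z₋ Z* b (trans (remove-other Z a b (a≢b ∘ sym)) Zb) Z*b agree₋)
                      (sym (card-remove Z a Za))
      where
      agree₋ : ∀ e → e ≢ b → lookup Z* e ≡ lookup Z₋ e
      agree₋ e nb with e ≟F a
      ... | yes refl = trans Z*a (sym (remove-at Z a))
      ... | no na = trans (others e na nb) (sym (remove-other Z a e na))
    outside-same : ∀ e → lookup (Z* ∖ B) e ≡ lookup (Z₋ ∖ B) e
    outside-same e with e ≟F a | e ≟F b
    ... | yes refl | _ = trans (lookup-∖ Z* B a) (trans (cong (_∧ not (lookup B a)) (trans Z*a (sym (remove-at Z a))))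
                               (sym (lookup-∖ Z₋ B a)))
    ... | no na | yes refl = trans (lookup-∖ Z* B b) (trans (cong (λ y → lookup Z* b ∧ not y) Bb)
                               (trans (∧-zeroʳ (lookup Z* b)) (trans (sym (∧-zeroʳ (lookup Z₋ b)))
                               (trans (cong (λ y → lookup Z₋ b ∧ not y) (sym Bb)) (sym (lookup-∖ Z₋ B b))))))
    ... | no na | no nb = trans (lookup-∖ Z* B e) (trans (cong (_∧ not (lookup B e)) (trans (others e na nb)
                               (sym (remove-other Z a e na)))) (sym (lookup-∖ Z₋ B e)))
    closer : suc ∣ Z* ∖ B ∣ ≡ ∣ Z ∖ B ∣
    closer = trans (cong suc (card-ext (Z* ∖ B) (Z₋ ∖ B) outside-same))
               (sym (card-add1 (Z₋ ∖ B) (Z ∖ B) a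
                  (trans (lookup-∖ Z₋ B a) (cong (_∧ not (lookup B a)) (remove-at Z a)))
                  (trans (lookup-∖ Z B a) (cong₂ (λ x y → x ∧ not y) Za Ba))
                  (λ e na → trans (lookup-∖ Z B e) (trans (cong (_∧ not (lookup B e)) (sym (remove-other Z a e na)))
                               (sym (lookup-∖ Z₋ B e))))))

  exchange-step : ∀ Y B → Basis Y B → ∀ Z → Indep S Z → Z ⊑ Y → ∀ z → lookup Z z ≡ true → lookup B z ≡ false →
    Σ (Subset N) λ Z* → Indep S Z* × Z* ⊑ Y × ∣ Z* ∣ ≡ ∣ Z ∣ × suc ∣ Z* ∖ B ∣ ≡ ∣ Z ∖ B ∣
  exchange-step Y B (iB , BY , maximal) Z iZ ZY z Zz Bz
    with any? (λ e0 → (lookup B e0 ≟B true) ×-dec (lookup Z e0 ≟B false))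
  ... | no B⊑Z = ⊥-elim (true≢false (trans (sym (maximal (insert B z) (Indep-⊑ S (insert B z) Z Bz⊑Z iZ) (⊑-insert B z)
                                      (λ e h → ZY e (Bz⊑Z e h)) z (insert-at B z))) Bz))
    where
    Bz⊑Z : insert B z ⊑ Z
    Bz⊑Z = insert-⊑ B Z z Zz (λ e be → not-false (λ nz → B⊑Z (e , be , nz)))
  ... | yes (e0 , Be0 , Ze0) = conclude (Augmenting.augment S g g-matching Z e0 j0 g-e0 iZ Ze0)
    where
    g : Matching r N
    g = proj₁ iB
    g-matching : IsMatching S g
    g-matching = proj₁ (proj₂ iB)
    j0 : Fin r
    j0 = proj₁ (proj₂ (proj₂ iB) e0 Be0)
    g-e0 : g e0 ≡ just j0
    g-e0 = proj₂ (proj₂ (proj₂ iB) e0 Be0)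
    z≢e0 : z ≢ e0
    z≢e0 refl = true≢false (trans (sym Be0) Bz)
    conclude : Augmenting.Outcome S g g-matching Z e0 j0 g-e0 →
               Σ (Subset N) λ Z* → Indep S Z* × Z* ⊑ Y × ∣ Z* ∣ ≡ ∣ Z ∣ × suc ∣ Z* ∖ B ∣ ≡ ∣ Z ∖ B ∣
    conclude (inj₁ iZ⁺) = Z* , Indep-⊑ S Z* (insert Z e0) (λ e h → proj₂ (remove-mem (insert Z e0) z e h)) iZ⁺ , Z*⊑Y ,
        exchange-sizes B Z Z* z e0 Zz Bz Ze0 Be0 (remove-at (insert Z e0) z)
          (trans (remove-other (insert Z e0) z e0 (z≢e0 ∘ sym)) (insert-at Z e0))
          (λ e nz ne → trans (remove-other (insert Z e0) z e nz) (insert-other Z e0 e ne))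
      where
      Z* : Subset N
      Z* = remove (insert Z e0) z
      Z*⊑Y : Z* ⊑ Y
      Z*⊑Y e h = insert-⊑ Z Y e0 (BY e0 Be0) ZY e (proj₂ (remove-mem (insert Z e0) z e h))
    conclude (inj₂ (z' , Zz' , g-z' , iZ*)) = Z* , iZ* , Z*⊑Y ,
        exchange-sizes B Z Z* z' e0 Zz' Bz' Ze0 Be0
          (trans (insert-other (remove Z z') e0 z' z'≢e0) (remove-at Z z')) (insert-at (remove Z z') e0)
          (λ e nz ne → trans (insert-other (remove Z z') e0 e ne) (remove-other Z z' e nz))
      where
      Z* : Subset N
      Z* = insert (remove Z z') e0
      Bz' : lookup B z' ≡ false
      Bz' = not-true (λ bz → nothing≢just (trans (sym g-z') (proj₂ (proj₂ (proj₂ iB) z' bz))))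
      z'≢e0 : z' ≢ e0
      z'≢e0 refl = true≢false (trans (sym Be0) Bz')
      Z*⊑Y : Z* ⊑ Y
      Z*⊑Y = insert-⊑ (remove Z z') Y e0 (BY e0 Be0) (λ e h → ZY e (proj₂ (remove-mem Z z' e h)))

  basis-maximum : ∀ Y B → Basis Y B → ∀ Z → Indep S Z → Z ⊑ Y → ∣ Z ∣ ≤ ∣ B ∣
  basis-maximum Y B bB Z0 iZ0 Z0Y = go N Z0 iZ0 Z0Y (∣p∣≤n (Z0 ∖ B))
    where
    go : (k : ℕ) (Z : Subset N) → Indep S Z → Z ⊑ Y → ∣ Z ∖ B ∣ ≤ k → ∣ Z ∣ ≤ ∣ B ∣
    go k Z iZ ZY bound with any? (λ z → (lookup Z z ≟B true) ×-dec (lookup B z ≟B false))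
    ... | no Z⊑B = card-mono Z B (λ e ze → not-false (λ nb → Z⊑B (e , ze , nb)))
    ... | yes (z , Zz , Bz) = shrink k bound (exchange-step Y B bB Z iZ ZY z Zz Bz)
      where
      shrink : (k : ℕ) → ∣ Z ∖ B ∣ ≤ k →
               Σ (Subset N) (λ Z* → Indep S Z* × Z* ⊑ Y × ∣ Z* ∣ ≡ ∣ Z ∣ × suc ∣ Z* ∖ B ∣ ≡ ∣ Z ∖ B ∣) → ∣ Z ∣ ≤ ∣ B ∣
      shrink zero b _ = ⊥-elim (<⇒≱ (card-pos (Z ∖ B) z (trans (lookup-∖ Z B z) (cong₂ (λ x y → x ∧ not y) Zz Bz))) b)
      shrink (suc k') b (Z* , iZ* , Z*Y , same , closer) =
        subst (_≤ ∣ B ∣) same (go k' Z* iZ* Z*Y (≤-pred (subst (_≤ suc k') (sym closer) b)))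

  -- If x is a coloop of M[S]|Y, every independent W ⊑ Y stays independent
  -- when x is added: extend W to a basis, which must contain x.
  coloop-insert : ∀ Y x W → IsColoopOf M[ S ] Y x → Indep S W → W ⊑ Y → Indep S (insert W x)
  coloop-insert Y x W (_ , in-every-basis) iW WY with extend Y W iW WY
  ... | B , bB , WB = Indep-⊑ S (insert W x) B (insert-⊑ W B x (∈⇒bit (in-every-basis B (Basis⇒IsBasisOf bB))) WB) (proj₁ bB)

  basis-avoiding : ∀ Y x → lookup Y x ≡ true → ¬ IsColoopOf M[ S ] Y x →
                   Σ (Subset N) λ B → Basis Y B × lookup B x ≡ false
  basis-avoiding Y x xY not-coloop with anySubset? (λ B → IsBasisOf? Y B ×-dec ¬? (x ∈? B))
  ... | yes (B , isB , x∉B) = B , IsBasisOf⇒Basis isB , not-true (x∉B ∘ bit⇒∈)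
  ... | no none = ⊥-elim (not-coloop (bit⇒∈ xY , λ B isB → decidable-stable (x ∈? B) (λ x∉B → none (B , isB , x∉B))))

open BasesOf

same-refl : ∀ {N} {M : IndepPred N} → SameMatroid M M
same-refl X = mk⇔ (λ x → x) (λ x → x)

same-sym : ∀ {N} {M M' : IndepPred N} → SameMatroid M M' → SameMatroid M' M
same-sym h X = mk⇔ (Equivalence.from (h X)) (Equivalence.to (h X))

same-trans : ∀ {N} {M M' M'' : IndepPred N} → SameMatroid M M' → SameMatroid M' M'' → SameMatroid M M''
same-trans h h' X = mk⇔ (Equivalence.to (h' X) ∘ Equivalence.to (h X)) (Equivalence.from (h X) ∘ Equivalence.from (h' X))

-- Single-element extensions M[A^I] of M[A].  Elements of E ∪ {x} are
-- x = zero and suc e for e ∈ E; the matroid  M[A^I] \ A_k  is the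
-- restriction to  Outside k , the complement of A_k.
module Extensions {r n : ℕ} (A : SetSystem r n) where

  Outside : Fin r → Subset (suc n)
  Outside k = ∁ (Lift (A k))

  Outside-tail : ∀ k (e : Fin n) → lookup (Outside k) (suc e) ≡ true → lookup (A k) e ≡ false
  Outside-tail k e h = not-true λ ake → true≢false (trans (sym h) (trans (lookup-∁ (Lift (A k)) (suc e)) (cong not ake)))

  Indep-tail : ∀ J (W : Subset (suc n)) → Indep (Ext A J) W → Indep A (tail W)
  Indep-tail J (b ∷ W) (m , (mem , inj) , cov) =
    m ∘ suc , ((λ e j eq → mem (suc e) j eq) , (λ e e' j a b → suc-injective (inj (suc e) (suc e') j a b))) ,
    (λ e we → cov (suc e) we)

  Indep-avoiding-x : ∀ J J' (W : Subset (suc n)) → lookup W zero ≡ false → Indep (Ext A J) W → Indep (Ext A J') W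
  Indep-avoiding-x J J' W w0 (m , (mem , inj) , cov) = m' , (mem' , inj') , cov'
    where
    m' : Matching r (suc n)
    m' zero = nothing
    m' (suc e) = m (suc e)
    mem' : ∀ e j → m' e ≡ just j → lookup (Ext A J' j) e ≡ true
    mem' (suc e) j eq = mem (suc e) j eq
    inj' : ∀ e e' j → m' e ≡ just j → m' e' ≡ just j → e ≡ e'
    inj' (suc e) (suc e') j a b = inj (suc e) (suc e') j a b
    cov' : Covers m' W
    cov' zero we = ⊥-elim (true≢false (trans (sym we) w0))
    cov' (suc e) we = cov (suc e) we

  Indep-add-x : ∀ J (W : Subset n) (m : Matching r n) → IsMatching A m → Covers m W → (j : Fin r) →
    lookup J j ≡ true → (∀ e → lookup W e ≡ true → m e ≢ just j) → Indep (Ext A J) (true ∷ W)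
  Indep-add-x J W m (mem , inj) cov j Jj avoid = m' , (mem' , inj') , cov'
    where
    m' : Matching r (suc n)
    m' zero = just j
    m' (suc e) = restrict m W e
    mem' : ∀ e j' → m' e ≡ just j' → lookup (Ext A J j') e ≡ true
    mem' zero j' refl = Jj
    mem' (suc e) j' eq = mem e j' (proj₂ (restrict-just m W e j' eq))
    inj' : ∀ e e' j' → m' e ≡ just j' → m' e' ≡ just j' → e ≡ e'
    inj' zero zero _ _ _ = refl
    inj' zero (suc e') j' refl b = let (we , me) = restrict-just m W e' j b in ⊥-elim (avoid e' we me)
    inj' (suc e) zero j' a refl = let (we , me) = restrict-just m W e j a in ⊥-elim (avoid e we me)
    inj' (suc e) (suc e') j' a b =
      cong suc (inj e e' j' (proj₂ (restrict-just m W e j' a)) (proj₂ (restrict-just m W e' j' b)))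
    cov' : Covers m' (true ∷ W)
    cov' zero _ = j , refl
    cov' (suc e) we = restrict-covers m W cov e we

  InL? : ∀ I → Dec (InL A I)
  InL? I = all? (λ k → ¬? (k ∈? I) →-dec ¬? (IsColoopOf? (Ext A I) (Outside k) x₀))

  -- If k ∈ I, k ∉ J and
  -- J ∈ L_A, some basis B of M[A^J] \ A_k avoids x; in M[A^I] the set
  -- B + x is independent (x matched to k), which is impossible in M[A^J].
  distinct-witness : ∀ {I J} k → lookup I k ≡ true → lookup J k ≡ false → InL A J →
    ¬ SameMatroid M[ Ext A I ] M[ Ext A J ]
  distinct-witness {I} {J} k Ik Jk LJ same
    with basis-avoiding (Ext A J) (Outside k) x₀ refl (LJ k (λ kJ → true≢false (trans (sym (∈⇒bit kJ)) Jk)))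
  ... | b ∷ B' , (iB , BY , maximal) , refl = true≢false (sym (maximal (true ∷ B') iJ x-free in-Outside zero refl))
    where
    iA : Indep A B'
    iA = Indep-tail J (false ∷ B') iB
    m : Matching r n
    m = proj₁ iA
    avoid : ∀ e → lookup B' e ≡ true → m e ≢ just k
    avoid e be me = true≢false (trans (sym (proj₁ (proj₁ (proj₂ iA)) e k me)) (Outside-tail k e (BY (suc e) be)))
    iI : Indep (Ext A I) (true ∷ B')
    iI = Indep-add-x I B' m (proj₁ (proj₂ iA)) (proj₂ (proj₂ iA)) k Ik avoid
    iJ : Indep (Ext A J) (true ∷ B')
    iJ = PT⇒Indep (Ext A J) (Equivalence.to (same (true ∷ B')) (Indep⇒PT (Ext A I) iI))
    x-free : (false ∷ B') ⊑ (true ∷ B')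
    x-free (suc e) h = h
    in-Outside : (true ∷ B') ⊑ Outside k
    in-Outside zero _ = refl
    in-Outside (suc e) h = BY (suc e) h

  distinct : ∀ {I J} → InL A I → InL A J → I ≢ J → ¬ SameMatroid M[ Ext A I ] M[ Ext A J ]
  distinct {I} {J} LI LJ I≢J same with all? (λ k → lookup I k ≟B lookup J k)
  ... | yes eq = I≢J (subset-ext I J eq)
  ... | no neq with ¬∀⟶∃¬ r _ (λ k → lookup I k ≟B lookup J k) neq
  ... | k , nk with lookup I k in ik | lookup J k in jk
  ... | true | true = nk refl
  ... | false | false = nk refl
  ... | true | false = distinct-witness {I} {J} k ik jk LJ same
  ... | false | true = distinct-witness {J} {I} k jk ik LI (same-sym same)

-- If k ∉ I and x is a coloop of M[A^I] \ A_k, then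
-- adding x to A_k does not change the extension:  M[A^I] = M[A^(I+k)].
-- The nontrivial inclusion: let φ match X in A^(I+k) with x ↦ k.  The
-- part W of X − x outside A_k is independent in M[A^I] \ A_k, so W + x is
-- matched by some ψ that never uses k.  Augmenting X − x along ψ in A^I
-- with A_k removed either matches all of X − x together with x, or frees
-- an element z ∈ A_k, which then takes the set k.
module SigmaStep {r n : ℕ} (A : SetSystem r n) (I : Subset r) (k : Fin r) (k∉I : lookup I k ≡ false)
                 (coloop : IsColoopOf M[ Ext A I ] (Extensions.Outside A k) x₀) where
  open Extensions A

  Aᵏ : SetSystem r (suc n)
  Aᵏ j = if does (j ≟F k) then ∅ else Ext A I j

  Aᵏ-⊑ : ∀ j → Aᵏ j ⊑ Ext A I j
  Aᵏ-⊑ j e h with j ≟F k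
  ... | yes _ = ⊥-elim (true≢false (trans (sym h) (lookup-∅ e)))
  ... | no _ = h

  Aᵏ-k : ∀ e → lookup (Aᵏ k) e ≡ false
  Aᵏ-k e with k ≟F k
  ... | yes _ = lookup-∅ e
  ... | no ne = ⊥-elim (ne refl)

  Aᵏ-other : ∀ j → j ≢ k → Aᵏ j ≡ Ext A I j
  Aᵏ-other j ne with j ≟F k
  ... | yes eq = ⊥-elim (ne eq)
  ... | no _ = refl

  into-Aᵏ : ∀ J (m : Matching r (suc n)) → (∀ j → j ≢ k → lookup J j ≡ lookup I j) →
    IsMatching (Ext A J) m → (∀ e j → m e ≡ just j → j ≢ k) → IsMatching Aᵏ m
  into-Aᵏ J m agree (mem , inj) avoids-k = mem' , inj
    where
    mem' : ∀ e j → m e ≡ just j → lookup (Aᵏ j) e ≡ true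
    mem' e j eq rewrite Aᵏ-other j (avoids-k e j eq) with e
    ... | zero = trans (sym (agree j (avoids-k zero j eq))) (mem zero j eq)
    ... | suc e' = mem (suc e') j eq

  module Absorb (X : Subset (suc n)) (φ : Matching r (suc n)) (φ-matching : IsMatching (Ext A (insert I k)) φ)
                (φ-covers : Covers φ X) (φ-x : φ zero ≡ just k) where

    X⁻ : Subset (suc n)
    X⁻ = remove X zero

    φ⁻ : Matching r (suc n)
    φ⁻ = assign φ zero nothing

    φ⁻-just : ∀ e j → φ⁻ e ≡ just j → e ≢ zero × φ e ≡ just j
    φ⁻-just zero j eq = ⊥-elim (nothing≢just (trans (sym (assign-at φ zero nothing)) eq))
    φ⁻-just (suc e) j eq = (λ ()) , trans (sym (assign-other φ zero nothing (suc e) (λ ()))) eq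

    φ⁻-matching : IsMatching Aᵏ φ⁻
    φ⁻-matching = into-Aᵏ (insert I k) φ⁻ (λ j ne → insert-other I k j ne)
      ((λ e j eq → proj₁ φ-matching e j (proj₂ (φ⁻-just e j eq))) ,
       (λ e e' j a b → proj₂ φ-matching e e' j (proj₂ (φ⁻-just e j a)) (proj₂ (φ⁻-just e' j b))))
      (λ { e j eq refl → proj₁ (φ⁻-just e j eq) (proj₂ φ-matching e zero k (proj₂ (φ⁻-just e k eq)) φ-x) })

    φ⁻-covers : Covers φ⁻ X⁻
    φ⁻-covers e ze = let (ne , Xe) = remove-mem X zero e ze
                         (j , φe) = φ-covers e Xe
                     in j , trans (assign-other φ zero nothing e ne) φe

    W : Subset (suc n)
    W = remove (X ∩ Outside k) zero

    W⊑X⁻ : W ⊑ X⁻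
    W⊑X⁻ e h = let (ne , XOe) = remove-mem (X ∩ Outside k) zero e h
               in trans (remove-other X zero e ne) (∧-conicalˡ _ _ (trans (sym (lookup-∩ X (Outside k) e)) XOe))

    W⊑Outside : W ⊑ Outside k
    W⊑Outside e h = ∧-conicalʳ _ _ (trans (sym (lookup-∩ X (Outside k) e)) (proj₂ (remove-mem (X ∩ Outside k) zero e h)))

    W⁺ : Subset (suc n)
    W⁺ = insert W zero

    W⁺⊑Outside : W⁺ ⊑ Outside k
    W⁺⊑Outside = insert-⊑ W (Outside k) zero refl W⊑Outside

    -- W + x is independent in M[A^I], since x is a coloop of M[A^I] \ A_k.
    W⁺-indep : Indep (Ext A I) W⁺
    W⁺-indep = coloop-insert (Ext A I) (Outside k) x₀ W coloop
      (Indep-weaken Aᵏ (Ext A I) Aᵏ-⊑ W (φ⁻ , φ⁻-matching , λ e h → φ⁻-covers e (W⊑X⁻ e h))) W⊑Outside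

    ψ : Matching r (suc n)
    ψ = proj₁ W⁺-indep

    ψ-covers : Covers ψ W⁺
    ψ-covers = proj₂ (proj₂ W⁺-indep)

    ψW : Matching r (suc n)
    ψW = restrict ψ W⁺

    -- Elements of W + x cannot use k: x ∉ A^I_k and W avoids A_k.
    ψW-matching : IsMatching Aᵏ ψW
    ψW-matching = into-Aᵏ I ψW (λ _ _ → refl) (restrict-matching {S = Ext A I} W⁺ (proj₁ (proj₂ W⁺-indep))) avoids-k
      where
      avoids-k : ∀ e j → ψW e ≡ just j → j ≢ k
      avoids-k zero j eq refl = let (_ , ψe) = restrict-just ψ W⁺ zero k eq
        in true≢false (trans (sym (proj₁ (proj₁ (proj₂ W⁺-indep)) zero k ψe)) k∉I)
      avoids-k (suc e) j eq refl = let (We , ψe) = restrict-just ψ W⁺ (suc e) k eq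
        in true≢false (trans (sym (proj₁ (proj₁ (proj₂ W⁺-indep)) (suc e) k ψe)) (Outside-tail k e (W⁺⊑Outside (suc e) We)))

    j0 : Fin r
    j0 = proj₁ (ψ-covers zero (insert-at W zero))

    ψW-x : ψW zero ≡ just j0
    ψW-x = trans (restrict-in ψ W⁺ zero (insert-at W zero)) (proj₂ (ψ-covers zero (insert-at W zero)))

    X⊑X⁻⁺ : X ⊑ insert X⁻ zero
    X⊑X⁻⁺ zero _ = insert-at X⁻ zero
    X⊑X⁻⁺ (suc e) h = trans (insert-other X⁻ zero (suc e) (λ ())) (trans (remove-other X zero (suc e) (λ ())) h)

    -- Second outcome of the augmentation: z ∈ X⁻ is freed.  As z ∉ W + x,
    -- z lies in A_k, and the unused set k can be given to z.
    give-k : ∀ z → lookup X⁻ z ≡ true → ψW z ≡ nothing → Indep Aᵏ (insert (remove X⁻ z) zero) → Indep (Ext A I) X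
    give-k zero X⁻z _ _ = ⊥-elim (proj₁ (remove-mem X zero zero X⁻z) refl)
    give-k (suc z') X⁻z ψW-z (m , (mem , inj) , cov) = m' , (mem' , inj') , cov'
      where
      z : Fin (suc n)
      z = suc z'
      z∉W⁺ : lookup W⁺ z ≡ false
      z∉W⁺ = not-true λ t → nothing≢just (trans (sym ψW-z) (trans (restrict-in ψ W⁺ z t) (proj₂ (ψ-covers z t))))
      z∈A : lookup (A k) z' ≡ true
      z∈A = not-false λ akz → true≢false (trans (sym (⊑-insert W zero z
              (trans (remove-other (X ∩ Outside k) zero z (λ ())) (trans (lookup-∩ X (Outside k) z)
                (cong₂ _∧_ (proj₂ (remove-mem X zero z X⁻z)) (trans (lookup-∁ (Lift (A k)) z) (cong not akz)))))))
              z∉W⁺)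
      m' : Matching r (suc n)
      m' = assign m z (just k)
      m-avoids-k : ∀ e → m e ≢ just k
      m-avoids-k e me = true≢false (trans (sym (mem e k me)) (Aᵏ-k e))
      mem' : ∀ e j → m' e ≡ just j → lookup (Ext A I j) e ≡ true
      mem' e j eq with e ≟F z
      ... | yes refl = subst (λ j → lookup (Ext A I j) z ≡ true) (just-injective eq) z∈A
      ... | no nz = Aᵏ-⊑ j e (mem e j eq)
      inj' : ∀ e e' j → m' e ≡ just j → m' e' ≡ just j → e ≡ e'
      inj' e e' j a b with e ≟F z | e' ≟F z
      ... | yes p | yes q = trans p (sym q)
      ... | yes p | no q = ⊥-elim (m-avoids-k e' (trans b (cong just (sym (just-injective a)))))
      ... | no p | yes q = ⊥-elim (m-avoids-k e (trans a (cong just (sym (just-injective b)))))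
      ... | no p | no q = inj e e' j a b
      cov' : Covers m' X
      cov' e xe with e ≟F z
      ... | yes refl = k , refl
      ... | no nz = cov e (in-Z e nz xe)
        where
        in-Z : ∀ e → e ≢ z → lookup X e ≡ true → lookup (insert (remove X⁻ z) zero) e ≡ true
        in-Z zero _ _ = insert-at (remove X⁻ z) zero
        in-Z (suc e') nz xe = trans (insert-other (remove X⁻ z) zero (suc e') (λ ()))
                          (trans (remove-other X⁻ z (suc e') nz) (trans (remove-other X zero (suc e') (λ ())) xe))

    absorb : Indep (Ext A I) X
    absorb = conclude (Augmenting.augment Aᵏ ψW ψW-matching X⁻ zero j0 ψW-x (φ⁻ , φ⁻-matching , φ⁻-covers) (remove-at X zero))
      where
      conclude : Augmenting.Outcome Aᵏ ψW ψW-matching X⁻ zero j0 ψW-x → Indep (Ext A I) X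
      conclude (inj₁ iX⁻⁺) = Indep-⊑ (Ext A I) X (insert X⁻ zero) X⊑X⁻⁺ (Indep-weaken Aᵏ (Ext A I) Aᵏ-⊑ (insert X⁻ zero) iX⁻⁺)
      conclude (inj₂ (z , X⁻z , ψW-z , iZ)) = give-k z X⁻z ψW-z iZ

  sigma-step : SameMatroid M[ Ext A I ] M[ Ext A (insert I k) ]
  sigma-step X = mk⇔ (Indep⇒PT (Ext A (insert I k)) ∘ enlarge ∘ PT⇒Indep (Ext A I))
                     (Indep⇒PT (Ext A I) ∘ shrink ∘ PT⇒Indep (Ext A (insert I k)))
    where
    enlarge : Indep (Ext A I) X → Indep (Ext A (insert I k)) X
    enlarge = Indep-weaken (Ext A I) (Ext A (insert I k)) (λ j → λ { zero h → ⊑-insert I k j h ; (suc e) h → h }) X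
    shrink : Indep (Ext A (insert I k)) X → Indep (Ext A I) X
    shrink (φ , (mem , inj) , cov) with ≡-dec-Maybe _≟F_ (φ zero) (just k)
    ... | yes φ-x = Absorb.absorb X φ (mem , inj) cov φ-x
    ... | no φ-x = φ , (mem' , inj) , cov
      where
      mem' : ∀ e j → φ e ≡ just j → lookup (Ext A I j) e ≡ true
      mem' zero j eq = trans (sym (insert-other I k j (λ { refl → φ-x eq }))) (mem zero j eq)
      mem' (suc e) j eq = mem (suc e) j eq

-- Every extension is attained at a fixed point of σ: adding indices k
-- whose x is a coloop of M[A^I] \ A_k never changes M[A^I], and this
-- stops after at most r steps at some J ∈ L_A.
closure : ∀ {r n} (A : SetSystem r n) I → Σ (Subset r) λ J → InL A J × SameMatroid M[ Ext A I ] M[ Ext A J ]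
closure {r} A I0 = go r I0 (∣p∣≤n (∁ I0))
  where
  open Extensions A
  go : (f : ℕ) (I : Subset r) → ∣ ∁ I ∣ ≤ f → Σ (Subset r) λ J → InL A J × SameMatroid M[ Ext A I ] M[ Ext A J ]
  go f I bound with InL? I
  ... | yes L = I , L , same-refl
  ... | no nL with ¬∀⟶∃¬ r _ (λ k → ¬? (k ∈? I) →-dec ¬? (IsColoopOf? (Ext A I) (Outside k) x₀)) nL
  ...   | k , nk = next f bound
    where
    k∉I : lookup I k ≡ false
    k∉I = not-true (λ t → nk (λ k∉I → ⊥-elim (k∉I (bit⇒∈ t))))
    coloop : IsColoopOf M[ Ext A I ] (Outside k) x₀
    coloop = decidable-stable (IsColoopOf? (Ext A I) (Outside k) x₀) (λ nc → nk (λ _ → nc))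
    next : (f : ℕ) → ∣ ∁ I ∣ ≤ f → Σ (Subset r) λ J → InL A J × SameMatroid M[ Ext A I ] M[ Ext A J ]
    next zero b = ⊥-elim (<⇒≱ (subst (0 <_) (sym (card-∁-insert I k k∉I)) (s≤s z≤n)) b)
    next (suc f) b with go f (insert I k) (≤-pred (subst (_≤ suc f) (card-∁-insert I k k∉I) b))
    ... | J , LJ , same = J , LJ , same-trans (SigmaStep.sigma-step A I k k∉I coloop) same

module Digraph {r n : ℕ} (A : SetSystem r n) where
  open Extensions A

  Arc : Fin r → Fin r → Set
  Arc k j = j ≢ k × IsColoopOf M[ Ext A ⁅ j ⁆ ] (Outside k) x₀

  Arc? : ∀ k j → Dec (Arc k j)
  Arc? k j = ¬? (j ≟F k) ×-dec IsColoopOf? (Ext A ⁅ j ⁆) (Outside k) x₀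

  -- D is kept abstract: only its two defining laws are used, and unfolding it
  -- would expose the (expensive) decision procedure for coloops.
  abstract
    D : Fin r → Subset r
    D k = subsetOf (Arc? k)

    D-sound : ∀ k j → lookup (D k) j ≡ true → Arc k j
    D-sound k = subsetOf-sound (Arc? k)

    D-complete : ∀ k j → Arc k j → lookup (D k) j ≡ true
    D-complete k = subsetOf-complete (Arc? k)

  D-irreflexive : ∀ k → lookup (D k) k ≡ false
  D-irreflexive k = not-true (λ h → proj₁ (D-sound k k h) refl)

  -- A basis of
  -- M[A^I] \ A_k avoiding x is independent in M[A^{j}], so it can be
  -- extended by x there, hence also in M[A^I], contradicting maximality.
  coloop-mono : ∀ I j k → lookup I j ≡ true → IsColoopOf M[ Ext A ⁅ j ⁆ ] (Outside k) x₀ →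
                IsColoopOf M[ Ext A I ] (Outside k) x₀
  coloop-mono I j k Ij col = proj₁ col , λ B isB → bit⇒∈ (contains-x B (IsBasisOf⇒Basis (Ext A I) isB))
    where
    singleton⊑I : ∀ j' → Ext A ⁅ j ⁆ j' ⊑ Ext A I j'
    singleton⊑I j' zero h = subst (λ j → lookup I j ≡ true) (sym (x∈⁅y⁆⇒x≡y j (bit⇒∈ h))) Ij
    singleton⊑I j' (suc e) h = h
    contains-x : ∀ B → Basis (Ext A I) (Outside k) B → lookup B zero ≡ true
    contains-x B (iB , BY , maximal) = not-false λ B0 → true≢false (trans (sym (grown B0)) B0)
      where
      grown : lookup B zero ≡ false → lookup B zero ≡ true
      grown B0 = maximal (insert B zero) iB⁺ (⊑-insert B zero) (insert-⊑ B (Outside k) zero refl BY) zero (insert-at B zero)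
        where
        iB⁺ : Indep (Ext A I) (insert B zero)
        iB⁺ = Indep-weaken (Ext A ⁅ j ⁆) (Ext A I) singleton⊑I (insert B zero)
                (coloop-insert (Ext A ⁅ j ⁆) (Outside k) x₀ B col (Indep-avoiding-x I ⁅ j ⁆ B B0 iB) BY)

  InL⇒closed : ∀ I → InL A I → ∀ k → lookup I k ≡ true ⊎ (∀ j → lookup I j ≡ true → lookup (D k) j ≡ false)
  InL⇒closed I L k with lookup I k in Ik
  ... | true = inj₁ refl
  ... | false = inj₂ λ j Ij → not-true λ d →
          L k (λ k∈I → true≢false (trans (sym (∈⇒bit k∈I)) Ik)) (coloop-mono I j k Ij (proj₂ (D-sound k j d)))

  -- Take a basis B of
  -- M \ A_k (of size ks), matched by m, and let U be the set indices m uses,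
  -- so ∣ U ∣ ≤ ks.  For j ∉ U + k, B + x is independent in M[A^{j}] \ A_k and
  -- larger than any independent set avoiding x, so every basis there
  -- contains x: j ∈ D_k.  Hence D_k ⊇ ∁ (U + k), of size ≥ r − ks − 1.
  module Outdegree (k : Fin r) (ks : ℕ) (B : Subset n) (pB : PartialTransversal A B) (B⊆∁A : B ⊆ ∁ (A k))
                   (∣B∣ : ∣ B ∣ ≡ ks) (rank-bound : ∀ C → M[ A ] C → C ⊆ ∁ (A k) → ∣ C ∣ ≤ ks) where

    iB : Indep A B
    iB = PT⇒Indep A pB

    m : Matching r n
    m = restrict (proj₁ iB) B

    m-matching : IsMatching A m
    m-matching = restrict-matching {S = A} B (proj₁ (proj₂ iB))

    m-covers : Covers m B
    m-covers = restrict-covers (proj₁ iB) B (proj₂ (proj₂ iB))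

    used? : ∀ j → Dec (Σ (Fin n) λ e → m e ≡ just j)
    used? j = any? (λ e → ≡-dec-Maybe _≟F_ (m e) (just j))

    U : Subset r
    U = subsetOf used?

    ∣U+k∣ : ∣ insert U k ∣ ≤ suc ks
    ∣U+k∣ = ≤-trans (card-insert≤ U k) (s≤s (≤-trans (card-image B U m preimage) (≤-reflexive ∣B∣)))
      where
      preimage : ∀ j → lookup U j ≡ true → Σ (Fin n) λ e → lookup B e ≡ true × m e ≡ just j
      preimage j u = let (e , me) = subsetOf-sound used? j u in e , proj₁ (restrict-just (proj₁ iB) B e j me) , me

    B⁺⊑Outside : (true ∷ B) ⊑ Outside k
    B⁺⊑Outside zero _ = refl
    B⁺⊑Outside (suc e) be = trans (lookup-∁ (Lift (A k)) (suc e)) (cong not B-outside)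
      where
      B-outside : lookup (A k) e ≡ false
      B-outside = trans (sym (not-involutive _)) (cong not (trans (sym (lookup-∁ (A k) e)) (∈⇒bit (B⊆∁A (bit⇒∈ be)))))

    -- A basis of M[A^{j}] \ A_k avoiding x would be independent in M \ A_k,
    -- hence of size ≤ ks, yet it is at least as large as B + x.
    coloop-at : ∀ j → lookup U j ≡ false → IsColoopOf M[ Ext A ⁅ j ⁆ ] (Outside k) x₀
    coloop-at j Uj = bit⇒∈ refl , λ Bs isBs → bit⇒∈ (contains-x Bs (IsBasisOf⇒Basis (Ext A ⁅ j ⁆) isBs))
      where
      contains-x : ∀ Bs → Basis (Ext A ⁅ j ⁆) (Outside k) Bs → lookup Bs zero ≡ true
      contains-x (true ∷ Bs) _ = refl
      contains-x (false ∷ Bs) (iBs , BsY , maximal) = ⊥-elim (<⇒≱ (s≤s ≤-refl) (≤-trans large small))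
        where
        small : ∣ Bs ∣ ≤ ks
        small = rank-bound Bs (Indep⇒PT A (Indep-tail ⁅ j ⁆ (false ∷ Bs) iBs))
                  (λ {e} eb → bit⇒∈ (trans (lookup-∁ (A k) e) (cong not (Outside-tail k e (BsY (suc e) (∈⇒bit eb))))))
        iB⁺ : Indep (Ext A ⁅ j ⁆) (true ∷ B)
        iB⁺ = Indep-add-x ⁅ j ⁆ B m m-matching m-covers j (∈⇒bit (x∈⁅x⁆ j))
                (λ e be me → subsetOf-false used? j Uj (e , me))
        large : suc ks ≤ ∣ Bs ∣
        large = subst (_≤ ∣ Bs ∣) (cong suc ∣B∣)
                  (basis-maximum (Ext A ⁅ j ⁆) (Outside k) (false ∷ Bs) (iBs , BsY , maximal) (true ∷ B) iB⁺ B⁺⊑Outside)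

    unused⊑D : ∁ (insert U k) ⊑ D k
    unused⊑D j h with j ≟F k | lookup U j in Uj
    ... | yes refl | _ = ⊥-elim (true≢false (trans (sym h) (trans (lookup-∁ (insert U k) k) (cong not (insert-at U k)))))
    ... | no j≢k | true = ⊥-elim (true≢false (trans (sym h) (trans (lookup-∁ (insert U k) j) (cong not (trans (insert-other U k j j≢k) Uj)))))
    ... | no j≢k | false = D-complete k j (j≢k , coloop-at j Uj)

    bound : r ∸ 1 ≤ ∣ D k ∣ + ks
    bound = begin
      r ∸ 1                        ≤⟨ r∸1≤ r ks ⟩
      (r ∸ suc ks) + ks            ≤⟨ +-monoˡ-≤ ks (∸-monoʳ-≤ r ∣U+k∣) ⟩
      (r ∸ ∣ insert U k ∣) + ks    ≡⟨ cong (_+ ks) (∣∁p∣≡n∸∣p∣ (insert U k)) ⟨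
      ∣ ∁ (insert U k) ∣ + ks      ≤⟨ +-monoˡ-≤ ks (card-mono (∁ (insert U k)) (D k) unused⊑D) ⟩
      ∣ D k ∣ + ks                 ∎
      where
      open ≤-Reasoning
      r∸1≤ : ∀ r ks → r ∸ 1 ≤ (r ∸ suc ks) + ks
      r∸1≤ zero ks = z≤n
      r∸1≤ (suc r) ks = ≤-trans (m≤n+m∸n r ks) (≤-reflexive (+-comm ks (r ∸ ks)))

  outdegree : ∀ k ks → RankOf M[ A ] (∁ (A k)) ks → r ∸ 1 ≤ ∣ D k ∣ + ks
  outdegree k ks ((B , pB , B⊆∁A , ∣B∣) , rank-bound) = Outdegree.bound k ks B pB B⊆∁A ∣B∣ rank-bound

  rank≤arcs : ∀ i → PresentationRank A i → i ≤ sum (tabulate (λ k → ∣ D k ∣))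
  rank≤arcs i (ks , rank-ks , i+Σks) = +-cancelʳ-≤ (sum (tabulate ks)) i _
    (begin
      i + sum (tabulate ks)                           ≡⟨ i+Σks ⟩
      r * (r ∸ 1)                                     ≡⟨ sym (sum-const r (r ∸ 1)) ⟩
      sum (tabulate {n = r} (λ _ → r ∸ 1))            ≤⟨ sum-mono (λ _ → r ∸ 1) (λ k → ∣ D k ∣ + ks k) (λ k → outdegree k (ks k) (rank-ks k)) ⟩
      sum (tabulate (λ k → ∣ D k ∣ + ks k))           ≡⟨ sum-+ (λ k → ∣ D k ∣) ks ⟩
      sum (tabulate (λ k → ∣ D k ∣)) + sum (tabulate ks) ∎)
    where open ≤-Reasoning

count : ∀ r → (Subset r → Bool) → ℕ
count zero P = if P [] then 1 else 0
count (suc r) P = count r (λ v → P (false ∷ v)) + count r (λ v → P (true ∷ v))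

enumerate : ∀ r → (Subset r → Bool) → List (Subset r)
enumerate zero P = if P [] then [] ∷ [] else []
enumerate (suc r) P =
  map (false ∷_) (enumerate r (λ v → P (false ∷ v))) ++ map (true ∷_) (enumerate r (λ v → P (true ∷ v)))

length-enumerate : ∀ r P → length (enumerate r P) ≡ count r P
length-enumerate zero P with P []
... | true = refl
... | false = refl
length-enumerate (suc r) P = trans (length-++ (map (false ∷_) (enumerate r (λ v → P (false ∷ v)))))
  (cong₂ _+_ (trans (length-map (false ∷_) (enumerate r (λ v → P (false ∷ v)))) (length-enumerate r _))
             (trans (length-map (true ∷_) (enumerate r (λ v → P (true ∷ v)))) (length-enumerate r _)))

enumerate-sound : ∀ r P I → I ∈ˡ enumerate r P → P I ≡ true
enumerate-sound zero P [] m with P []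
enumerate-sound zero P [] (here refl) | true = refl
enumerate-sound zero P [] (there ()) | true
enumerate-sound zero P [] () | false
enumerate-sound (suc r) P I m with ∈-++⁻ (map (false ∷_) (enumerate r (λ v → P (false ∷ v)))) m
... | inj₁ m₀ with ∈-map⁻ (false ∷_) m₀
...   | v , mv , refl = enumerate-sound r _ v mv
enumerate-sound (suc r) P I m | inj₂ m₁ with ∈-map⁻ (true ∷_) m₁
...   | v , mv , refl = enumerate-sound r _ v mv

enumerate-complete : ∀ r P I → P I ≡ true → I ∈ˡ enumerate r P
enumerate-complete zero P [] t with P []
enumerate-complete zero P [] refl | true = here refl
enumerate-complete (suc r) P (false ∷ v) t = ∈-++⁺ˡ (∈-map⁺ (false ∷_) (enumerate-complete r _ v t))
enumerate-complete (suc r) P (true ∷ v) t =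
  ∈-++⁺ʳ (map (false ∷_) (enumerate r (λ v → P (false ∷ v)))) (∈-map⁺ (true ∷_) (enumerate-complete r _ v t))

enumerate-unique : ∀ r P → Unique (enumerate r P)
enumerate-unique zero P with P []
... | true = All.[] ∷ []
... | false = []
enumerate-unique (suc r) P =
  Unique.++⁺ (Unique.map⁺ ∷-injective (enumerate-unique r _)) (Unique.map⁺ ∷-injective (enumerate-unique r _)) disjoint
  where
  ∷-injective : ∀ {b} {x y : Subset r} → _≡_ {A = Subset (suc r)} (b ∷ x) (b ∷ y) → x ≡ y
  ∷-injective refl = refl
  disjoint : ∀ {v} → v ∈ˡ map (false ∷_) (enumerate r (λ v → P (false ∷ v))) ×
                     v ∈ˡ map (true ∷_) (enumerate r (λ v → P (true ∷ v))) → ⊥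
  disjoint (m₀ , m₁) with ∈-map⁻ (false ∷_) m₀ | ∈-map⁻ (true ∷_) m₁
  ... | _ , _ , refl | _ , _ , ()

count-mono : ∀ r (P Q : Subset r → Bool) → (∀ I → P I ≡ true → Q I ≡ true) → count r P ≤ count r Q
count-mono zero P Q h with P [] | Q [] | h []
... | true | true | _ = ≤-refl
... | true | false | k = ⊥-elim (true≢false (sym (k refl)))
... | false | _ | _ = z≤n
count-mono (suc r) P Q h = +-mono-≤ (count-mono r _ _ (λ v → h (false ∷ v))) (count-mono r _ _ (λ v → h (true ∷ v)))

count-none : ∀ r (P : Subset r → Bool) → (∀ I → P I ≢ true) → count r P ≡ 0
count-none r P h = n≤0⇒n≡0 (≤-trans (count-mono r P (λ _ → false) (λ I t → ⊥-elim (h I t))) (≤-reflexive (count-false r)))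
  where
  count-false : ∀ r → count r (λ _ → false) ≡ 0
  count-false zero = refl
  count-false (suc r) = cong₂ _+_ (count-false r) (count-false r)

count-all : ∀ r → count r (λ _ → true) ≡ 2 ^ r
count-all zero = refl
count-all (suc r) = trans (cong₂ _+_ (count-all r) (count-all r)) (cong (2 ^ r +_) (sym (+-identityʳ _)))

count-split : ∀ r (P Q : Subset r → Bool) → count r P ≡ count r (λ I → P I ∧ Q I) + count r (λ I → P I ∧ not (Q I))
count-split zero P Q with P [] | Q []
... | true | true = refl
... | true | false = refl
... | false | _ = refl
count-split (suc r) P Q = trans (cong₂ _+_ (count-split r _ _) (count-split r _ _))
  (interchange (count r (λ v → P (false ∷ v) ∧ Q (false ∷ v))) (count r (λ v → P (false ∷ v) ∧ not (Q (false ∷ v))))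
               (count r (λ v → P (true ∷ v) ∧ Q (true ∷ v))) (count r (λ v → P (true ∷ v) ∧ not (Q (true ∷ v)))))
  where
  interchange : ∀ a b c d → a + b + (c + d) ≡ a + c + (b + d)
  interchange = solve-∀

count-constrained : ∀ r (P : Subset r → Bool) (Z T : Subset r) →
  (∀ I → P I ≡ true → (∀ k → lookup Z k ≡ true → lookup I k ≡ false) × (∀ k → lookup T k ≡ true → lookup I k ≡ true)) →
  count r P * 2 ^ (∣ Z ∣ + ∣ T ∣) ≤ 2 ^ r
count-constrained zero P [] [] h with P []
... | true = ≤-refl
... | false = z≤n
count-constrained (suc r) P (z ∷ Z) (t ∷ T) h = by-first-bit z t refl refl
  where
  tail-constraints : ∀ b v → P (b ∷ v) ≡ true →
    (∀ k → lookup Z k ≡ true → lookup v k ≡ false) × (∀ k → lookup T k ≡ true → lookup v k ≡ true)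
  tail-constraints b v pv = (λ k → proj₁ (h (b ∷ v) pv) (suc k)) , (λ k → proj₂ (h (b ∷ v) pv) (suc k))
  c₀ c₁ : ℕ
  c₀ = count r (λ v → P (false ∷ v))
  c₁ = count r (λ v → P (true ∷ v))
  bound₀ : c₀ * 2 ^ (∣ Z ∣ + ∣ T ∣) ≤ 2 ^ r
  bound₀ = count-constrained r _ Z T (tail-constraints false)
  bound₁ : c₁ * 2 ^ (∣ Z ∣ + ∣ T ∣) ≤ 2 ^ r
  bound₁ = count-constrained r _ Z T (tail-constraints true)
  -- A fixed first bit rules out one half of the sets.
  no-true : z ≡ true → c₁ ≡ 0
  no-true refl = count-none r _ λ v pv → true≢false (proj₁ (h (true ∷ v) pv) zero refl)
  no-false : t ≡ true → c₀ ≡ 0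
  no-false refl = count-none r _ λ v pv → true≢false (sym (proj₂ (h (false ∷ v) pv) zero refl))
  double : ∀ c X → c * X ≤ 2 ^ r → c * (2 * X) ≤ 2 ^ suc r
  double c X le = ≤-trans (≤-reflexive (regroup c X)) (*-monoʳ-≤ 2 le)
    where
    regroup : ∀ c X → c * (2 * X) ≡ 2 * (c * X)
    regroup = solve-∀
  by-first-bit : ∀ z' t' → z ≡ z' → t ≡ t' → count (suc r) P * 2 ^ (∣ z' ∷ Z ∣ + ∣ t' ∷ T ∣) ≤ 2 ^ suc r
  by-first-bit false false _ _ =
    ≤-trans (≤-reflexive (*-distribʳ-+ (2 ^ (∣ Z ∣ + ∣ T ∣)) c₀ c₁))
            (+-mono-≤ bound₀ (≤-trans bound₁ (≤-reflexive (sym (+-identityʳ _)))))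
  by-first-bit true false z≡ _ rewrite no-true z≡ | +-identityʳ c₀ = double c₀ _ bound₀
  by-first-bit false true _ t≡ rewrite no-false t≡ | +-suc ∣ Z ∣ ∣ T ∣ = double c₁ _ bound₁
  by-first-bit true true z≡ t≡ rewrite no-true z≡ | no-false t≡ = z≤n

-- Bound c s X N says  c·X ≤ (1/2 + 1/2^(s+1))·N ,
-- cleared of denominators; s will be a number of arcs, X a power of 2
-- weighting sets by the coordinates already fixed, and N = 2^r.
Bound : ℕ → ℕ → ℕ → ℕ → Set
Bound c s X N = c * 2 ^ suc s * X ≤ (2 ^ s + 1) * N

2^-positive : ∀ k → 1 ≤ 2 ^ k
2^-positive zero = s≤s z≤n
2^-positive (suc k) = ≤-trans (2^-positive k) (m≤m+n (2 ^ k) _)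

sum≤product+1 : ∀ a b → 1 ≤ a → 1 ≤ b → a + b ≤ a * b + 1
sum≤product+1 (suc a) (suc b) _ _ = ≤-trans (m≤m+n (suc a + suc b) (a * b)) (≤-reflexive (expand a b))
  where
  expand : ∀ a b → (1 + a) + (1 + b) + a * b ≡ (1 + a) * (1 + b) + 1
  expand = solve-∀

bound-antitone : ∀ c Y N t s → t ≤ s → Bound c s Y N → Bound c t Y N
bound-antitone c Y N t s t≤s h = *-cancelʳ-≤ (c * 2 ^ suc t * Y) ((2 ^ t + 1) * N) R {{>-nonZero (2^-positive d)}} scaled
  where
  d R P : ℕ
  d = s ∸ t
  R = 2 ^ d
  P = 2 ^ t
  2^s : 2 ^ s ≡ P * R
  2^s = trans (cong (2 ^_) (sym (m+[n∸m]≡n t≤s))) (^-distribˡ-+-* 2 t d)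
  h' : c * (2 * (P * R)) * Y ≤ (P * R + 1) * N
  h' = subst (λ x → c * (2 * x) * Y ≤ (x + 1) * N) 2^s h
  regroup : ∀ c P R Y → c * (2 * P) * Y * R ≡ c * (2 * (P * R)) * Y
  regroup = solve-∀
  spread : ∀ P R N → 1 ≤ R → (P * R + 1) * N ≤ (P + 1) * N * R
  spread P (suc R) N _ = ≤-trans (m≤m+n _ (R * N)) (≤-reflexive (expand P R N))
    where
    expand : ∀ P R N → (P * (1 + R) + 1) * N + R * N ≡ (P + 1) * N * (1 + R)
    expand = solve-∀
  scaled : c * 2 ^ suc t * Y * R ≤ (2 ^ t + 1) * N * R
  scaled = ≤-trans (≤-reflexive (regroup c P R Y)) (≤-trans h' (spread P R N (2^-positive d)))

bound-no-arcs : ∀ c X N → c * X ≤ N → Bound c 0 X N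
bound-no-arcs c X N h = ≤-trans (≤-reflexive (regroup c X)) (≤-trans (*-monoˡ-≤ 2 h) (≤-reflexive (*-comm N 2)))
  where
  regroup : ∀ c X → c * 2 * X ≡ c * X * 2
  regroup = solve-∀

bound-quarters : ∀ c₁ c₂ X N s → c₁ * (X * 4) ≤ N → c₂ * (X * 4) ≤ N → Bound (c₁ + c₂) s X N
bound-quarters c₁ c₂ X N s h₁ h₂ =
  ≤-trans (≤-reflexive (regroup c₁ c₂ X (2 ^ s)))
          (≤-trans (*-monoˡ-≤ (2 ^ s) half) (≤-trans (m≤m+n _ N) (≤-reflexive (collect (2 ^ s) N))))
  where
  regroup : ∀ c₁ c₂ X P → (c₁ + c₂) * (2 * P) * X ≡ ((c₁ + c₂) * X * 2) * P
  regroup = solve-∀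
  collect : ∀ P N → N * P + N ≡ (P + 1) * N
  collect = solve-∀
  split : ∀ c₁ c₂ X → (c₁ + c₂) * X * 2 * 2 ≡ c₁ * (X * 4) + c₂ * (X * 4)
  split = solve-∀
  twice : ∀ N → N + N ≡ N * 2
  twice = solve-∀
  half : (c₁ + c₂) * X * 2 ≤ N
  half = *-cancelʳ-≤ ((c₁ + c₂) * X * 2) N 2
           (≤-trans (≤-reflexive (split c₁ c₂ X)) (≤-trans (+-mono-≤ h₁ h₂) (≤-reflexive (twice N))))

-- The inductive step at a sink: c₁ sets weighted by 2^(c+1) fit in N, and
-- c₂ sets weighted by 2 satisfy the bound for s' ≥ s − c arcs; together the
-- c₁ + c₂ sets satisfy the bound for s, provided 1 ≤ c ≤ s.
bound-sink : ∀ c₁ c₂ X N s s' c → 1 ≤ c → c ≤ s → s ≤ s' + c →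
  c₁ * (X * 2 ^ suc c) ≤ N → Bound c₂ s' (2 * X) N → Bound (c₁ + c₂) s X N
bound-sink c₁ c₂ X N s s' (suc c') _ c≤s s≤s'+c h₁ h₂ =
  subst (λ x → (c₁ + c₂) * (2 * x) * X ≤ (x + 1) * N) (sym 2^s) combined
  where
  c t P Q : ℕ
  c = suc c'
  t = s ∸ c
  P = 2 ^ t
  Q = 2 ^ c'
  2^s : 2 ^ s ≡ P * (2 * Q)
  2^s = trans (cong (2 ^_) (sym (m∸n+n≡m c≤s))) (^-distribˡ-+-* 2 t c)
  h₂' : c₂ * (2 * P) * (2 * X) ≤ (P + 1) * N
  h₂' = bound-antitone c₂ (2 * X) N t s' (≤-trans (∸-monoˡ-≤ c s≤s'+c) (≤-reflexive (m+n∸n≡m s' c))) h₂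
  regroup : ∀ c₁ c₂ X P Q → (c₁ + c₂) * (2 * (P * (2 * Q))) * X ≡ c₁ * (X * (2 * (2 * Q))) * P + c₂ * (2 * P) * (2 * X) * Q
  regroup = solve-∀
  collect : ∀ N P Q → N * P + (P + 1) * N * Q ≡ N * (P + P * Q + Q)
  collect = solve-∀
  finish : ∀ N P Q → N * (P * Q + 1 + P * Q) ≡ (P * (2 * Q) + 1) * N
  finish = solve-∀
  reorder : ∀ P Q → P + P * Q + Q ≡ P + Q + P * Q
  reorder = solve-∀
  inner : P + P * Q + Q ≤ P * Q + 1 + P * Q
  inner = ≤-trans (≤-reflexive (reorder P Q)) (+-monoˡ-≤ (P * Q) (sum≤product+1 P Q (2^-positive t) (2^-positive c')))
  combined : (c₁ + c₂) * (2 * (P * (2 * Q))) * X ≤ (P * (2 * Q) + 1) * N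
  combined = begin
    (c₁ + c₂) * (2 * (P * (2 * Q))) * X                    ≡⟨ regroup c₁ c₂ X P Q ⟩
    c₁ * (X * (2 * (2 * Q))) * P + c₂ * (2 * P) * (2 * X) * Q ≤⟨ +-mono-≤ (*-monoˡ-≤ P h₁) (*-monoˡ-≤ Q h₂') ⟩
    N * P + (P + 1) * N * Q                                 ≡⟨ collect N P Q ⟩
    N * (P + P * Q + Q)                                     ≤⟨ *-monoʳ-≤ N inner ⟩
    N * (P * Q + 1 + P * Q)                                 ≡⟨ finish N P Q ⟩
    (P * (2 * Q) + 1) * N                                   ∎
    where open ≤-Reasoning

bound-half : ∀ l r s → r ≤ s → Bound l s 1 (2 ^ r) → l ≤ 2 ^ (r ∸ 1)
bound-half l r s r≤s h with 2 ^ (r ∸ 1) <? l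
... | no l≯ = ≮⇒≥ l≯
... | yes l> = ⊥-elim (<⇒≱ (too-many r r≤s (≤-trans (*-monoˡ-≤ (2 ^ suc s) l>) h')) ≤-refl)
  where
  h' : l * 2 ^ suc s ≤ (2 ^ s + 1) * 2 ^ r
  h' = ≤-trans (≤-reflexive (sym (*-identityʳ _))) h
  too-many : ∀ r → r ≤ s → suc (2 ^ (r ∸ 1)) * 2 ^ suc s ≤ (2 ^ s + 1) * 2 ^ r →
             (2 ^ s + 1) * 2 ^ r < (2 ^ s + 1) * 2 ^ r
  too-many zero _ le = ≤-trans (base (2 ^ s) (2^-positive s)) le
    where
    base : ∀ P → 1 ≤ P → suc ((P + 1) * 1) ≤ 2 * (2 * P)
    base (suc p) _ = ≤-trans (m≤m+n _ (3 * p + 1)) (≤-reflexive (expand p))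
      where
      expand : ∀ p → suc ((1 + p + 1) * 1) + (3 * p + 1) ≡ 2 * (2 * (1 + p))
      expand = solve-∀
  too-many (suc r') r≤ le = ≤-trans strict le
    where
    P R : ℕ
    P = 2 ^ s
    R = 2 ^ r'
    2R≤P : 2 * R ≤ P
    2R≤P = ^-monoʳ-≤ 2 r≤
    lhs : ∀ P R → (P + 1) * (2 * R) ≡ P * (2 * R) + 2 * R
    lhs = solve-∀
    rhs : ∀ P R → suc R * (2 * P) ≡ P * (2 * R) + (P + P)
    rhs = solve-∀
    strict : suc ((P + 1) * (2 * R)) ≤ suc R * (2 * P)
    strict = subst₂ (λ a b → suc a ≤ b) (sym (lhs P R)) (sym (rhs P R))
      (subst (_≤ P * (2 * R) + (P + P)) (+-suc (P * (2 * R)) (2 * R))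
        (+-monoʳ-≤ (P * (2 * R)) (≤-trans (s≤s 2R≤P) (+-monoˡ-≤ P (2^-positive s)))))

bound-count-mono : ∀ c c' s X N → c ≤ c' → Bound c' s X N → Bound c s X N
bound-count-mono c c' s X N c≤c' = ≤-trans (*-monoˡ-≤ X (*-monoˡ-≤ (2 ^ suc s) c≤c'))

-- The proof counts, more generally,
-- closed sets avoiding a set Z, by induction on the complement of Z.
module ClosedSets {r : ℕ} (D : Fin r → Subset r) (D-irreflexive : ∀ k → lookup (D k) k ≡ false) where

  Closed : Subset r → Set
  Closed I = ∀ k j → lookup (D k) j ≡ true → lookup I j ≡ true → lookup I k ≡ true

  Avoids : Subset r → Subset r → Set
  Avoids Z I = ∀ k → lookup Z k ≡ true → lookup I k ≡ false

  Good : Subset r → Subset r → Set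
  Good Z I = Avoids Z I × Closed I

  Good? : ∀ Z I → Dec (Good Z I)
  Good? Z I = all? (λ k → (lookup Z k ≟B true) →-dec (lookup I k ≟B false))
              ×-dec all? (λ k → all? λ j → (lookup (D k) j ≟B true) →-dec ((lookup I j ≟B true) →-dec (lookup I k ≟B true)))

  good : Subset r → Subset r → Bool
  good Z I = does (Good? Z I)

  good-sound : ∀ Z I → good Z I ≡ true → Good Z I
  good-sound Z I = does-true (Good? Z I)

  good-complete : ∀ Z I → Good Z I → good Z I ≡ true
  good-complete Z I = does-intro (Good? Z I)

  arcs-from : Subset r → Fin r → ℕ
  arcs-from Z k = if lookup Z k then 0 else ∣ D k ∩ ∁ Z ∣

  arcs : Subset r → ℕ
  arcs Z = sum (tabulate (arcs-from Z))

  ClosedBound : Subset r → Set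
  ClosedBound Z = Bound (count r (good Z)) (arcs Z) (2 ^ ∣ Z ∣) (2 ^ r)

  with-v without-v : Subset r → Fin r → Subset r → Bool
  with-v Z v I = good Z I ∧ lookup I v
  without-v Z v I = good Z I ∧ not (lookup I v)

  with-v-sound : ∀ Z v I → with-v Z v I ≡ true → Good Z I × lookup I v ≡ true
  with-v-sound Z v I h = good-sound Z I (∧-conicalˡ (good Z I) _ h) , ∧-conicalʳ _ (lookup I v) h

  without-v-sound : ∀ Z v I → without-v Z v I ≡ true → Good Z I × lookup I v ≡ false
  without-v-sound Z v I h = good-sound Z I (∧-conicalˡ (good Z I) _ h) , not-true⇒false (∧-conicalʳ _ (not (lookup I v)) h)

  split-at : ∀ Z v s X N → Bound (count r (with-v Z v) + count r (without-v Z v)) s X N → Bound (count r (good Z)) s X N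
  split-at Z v s X N = subst (λ c → Bound c s X N) (sym (count-split r (good Z) (λ I → lookup I v)))

  weight : ∀ (Z : Subset r) t → 2 ^ (∣ Z ∣ + t) ≡ 2 ^ ∣ Z ∣ * 2 ^ t
  weight Z t = ^-distribˡ-+-* 2 ∣ Z ∣ t

  ∣∅∣ : ∣ ∅ {r} ∣ ≡ 0
  ∣∅∣ = ∣∅∣≡0 r

  bound-without-arcs : ∀ Z → (∀ k v → lookup Z k ≡ false → lookup (D k) v ≡ true → lookup Z v ≡ false → ⊥) → ClosedBound Z
  bound-without-arcs Z no-arc = subst (λ s → Bound (count r (good Z)) s (2 ^ ∣ Z ∣) (2 ^ r)) (sym no-arcs)
    (bound-no-arcs (count r (good Z)) (2 ^ ∣ Z ∣) (2 ^ r) fits)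
    where
    none-from : ∀ k → arcs-from Z k ≡ 0
    none-from k with lookup Z k in Zk
    ... | true = refl
    ... | false = card-zero (D k ∩ ∁ Z) λ v h → let (Dkv , ∁Zv) = ∩-true (D k) (∁ Z) v h in no-arc k v Zk Dkv (∁-true Z v ∁Zv)
    no-arcs : arcs Z ≡ 0
    no-arcs = sum-zero (arcs-from Z) none-from
    fits : count r (good Z) * 2 ^ ∣ Z ∣ ≤ 2 ^ r
    fits = subst (λ t → count r (good Z) * 2 ^ t ≤ 2 ^ r) (trans (cong (∣ Z ∣ +_) ∣∅∣) (+-identityʳ ∣ Z ∣))
      (count-constrained r (good Z) Z ∅ λ I g → proj₁ (good-sound Z I g) , λ k e → ⊥-elim (true≢false (trans (sym e) (lookup-∅ k))))

  -- A path k → v → u outside Z: good sets containing v contain k, good sets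
  -- avoiding v avoid u; either way two more coordinates are fixed.
  bound-path : ∀ Z k v u → lookup Z k ≡ false → lookup (D k) v ≡ true → lookup Z v ≡ false →
               lookup (D v) u ≡ true → lookup Z u ≡ false → ClosedBound Z
  bound-path Z k v u Zk Dkv Zv Dvu Zu =
    split-at Z v (arcs Z) (2 ^ ∣ Z ∣) (2 ^ r) (bound-quarters (count r (with-v Z v)) (count r (without-v Z v)) (2 ^ ∣ Z ∣) (2 ^ r) (arcs Z) with-v-quarter without-v-quarter)
    where
    v≢k : v ≢ k
    v≢k refl = true≢false (trans (sym Dkv) (D-irreflexive v))
    u≢v : u ≢ v
    u≢v refl = true≢false (trans (sym Dvu) (D-irreflexive u))
    T₁ : Subset r
    T₁ = insert (insert ∅ v) k
    weight₁ : 2 ^ (∣ Z ∣ + ∣ T₁ ∣) ≡ 2 ^ ∣ Z ∣ * 4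
    weight₁ = trans (cong (λ t → 2 ^ (∣ Z ∣ + t)) (trans (card-insert-two ∅ v k (lookup-∅ v) (lookup-∅ k) v≢k) (cong (2 +_) ∣∅∣)))
                    (weight Z 2)
    with-v-quarter : count r (with-v Z v) * (2 ^ ∣ Z ∣ * 4) ≤ 2 ^ r
    with-v-quarter = subst (λ x → count r (with-v Z v) * x ≤ 2 ^ r) weight₁
      (count-constrained r (with-v Z v) Z T₁ λ I h → let ((avoids , closed) , Iv) = with-v-sound Z v I h in
        avoids , insert-⊑ (insert ∅ v) I k (closed k v Dkv Iv) (insert-⊑ ∅ I v Iv λ e ∅e → ⊥-elim (true≢false (trans (sym ∅e) (lookup-∅ e)))))
    Z₂ : Subset r
    Z₂ = insert (insert Z v) u
    weight₂ : 2 ^ (∣ Z₂ ∣ + ∣ ∅ {r} ∣) ≡ 2 ^ ∣ Z ∣ * 4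
    weight₂ = trans (cong (2 ^_) (trans (cong₂ _+_ (card-insert-two Z v u Zv Zu (u≢v ∘ sym)) ∣∅∣)
                                        (trans (+-identityʳ (2 + ∣ Z ∣)) (+-comm 2 ∣ Z ∣))))
                    (weight Z 2)
    without-v-quarter : count r (without-v Z v) * (2 ^ ∣ Z ∣ * 4) ≤ 2 ^ r
    without-v-quarter = subst (λ x → count r (without-v Z v) * x ≤ 2 ^ r) weight₂
      (count-constrained r (without-v Z v) Z₂ ∅ λ I h → let ((avoids , closed) , Iv) = without-v-sound Z v I h in
        avoids₂ I avoids closed Iv , λ e ∅e → ⊥-elim (true≢false (trans (sym ∅e) (lookup-∅ e))))
      where
      avoids₂ : ∀ I → Avoids Z I → Closed I → lookup I v ≡ false → Avoids Z₂ I
      avoids₂ I avoids closed Iv e Z₂e with insert-mem (insert Z v) u e Z₂e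
      ... | inj₁ refl = not-true λ Iu → true≢false (trans (sym (closed v u Dvu Iu)) Iv)
      ... | inj₂ Z₁e with insert-mem Z v e Z₁e
      ...   | inj₁ refl = Iv
      ...   | inj₂ Ze = avoids e Ze

  -- Good sets containing v contain all c ≥ 1 in-neighbours of v
  -- outside Z; good sets avoiding v are good for Z + v, which loses at most
  -- the c arcs into v.
  module Sink (Z : Subset r) (k v : Fin r) (Zk : lookup Z k ≡ false) (Dkv : lookup (D k) v ≡ true)
              (Zv : lookup Z v ≡ false) (sink : ∀ u → lookup (D v) u ≡ true → lookup Z u ≡ false → ⊥) where

    X N : ℕ
    X = 2 ^ ∣ Z ∣
    N = 2 ^ r

    Z⁺ : Subset r
    Z⁺ = insert Z v

    into-v : Fin r → Bool
    into-v k' = not (lookup Z k') ∧ lookup (D k') v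

    In : Subset r
    In = tabulate into-v

    In-at : ∀ k' → lookup In k' ≡ into-v k'
    In-at = lookup∘tabulate into-v

    c : ℕ
    c = ∣ In ∣

    1≤c : 1 ≤ c
    1≤c = card-pos In k (trans (In-at k) (cong₂ _∧_ (cong not Zk) Dkv))

    indicator : Fin r → ℕ
    indicator k' = if into-v k' then 1 else 0

    c≡ : c ≡ sum (tabulate indicator)
    c≡ = card-as-sum into-v

    indicator≤ : ∀ k' → indicator k' ≤ arcs-from Z k'
    indicator≤ k' with lookup Z k' in Zk'
    ... | true = z≤n
    ... | false with lookup (D k') v in Dk'v
    ...   | false = z≤n
    ...   | true = card-pos (D k' ∩ ∁ Z) v (∩∁-intro (D k') Z v Dk'v Zv)

    c≤arcs : c ≤ arcs Z
    c≤arcs = ≤-trans (≤-reflexive c≡) (sum-mono indicator (arcs-from Z) indicator≤)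

    -- Passing from Z to Z + v loses no arc out of v (v is a sink outside Z)
    -- and, out of k' ≠ v, at most the arc k' → v.
    no-arcs-from-v : arcs-from Z v ≡ 0
    no-arcs-from-v = trans (cong (λ b → if b then 0 else ∣ D v ∩ ∁ Z ∣) Zv)
      (card-zero (D v ∩ ∁ Z) λ u h → let (Dvu , ∁Zu) = ∩-true (D v) (∁ Z) u h in sink u Dvu (∁-true Z u ∁Zu))

    arcs-lost : ∀ k' → k' ≢ v → ∣ D k' ∩ ∁ Z ∣ ≤ ∣ D k' ∩ ∁ Z⁺ ∣ + (if lookup (D k') v then 1 else 0)
    arcs-lost k' k'≢v = ≤-trans (card≤remove+bit q v)
      (≤-reflexive (cong₂ _+_ (card-ext (remove q v) (D k' ∩ ∁ Z⁺) same) (cong (λ b → if b then 1 else 0) q-v)))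
      where
      q : Subset r
      q = D k' ∩ ∁ Z
      q-v : lookup q v ≡ lookup (D k') v
      q-v = trans (lookup-∩ (D k') (∁ Z) v) (trans (cong (lookup (D k') v ∧_) (trans (lookup-∁ Z v) (cong not Zv))) (∧-identityʳ _))
      same : ∀ e → lookup (remove q v) e ≡ lookup (D k' ∩ ∁ Z⁺) e
      same e with e ≟F v
      ... | yes refl = trans (remove-at q v) (sym (trans (lookup-∩ (D k') (∁ Z⁺) v)
                         (trans (cong (lookup (D k') v ∧_) (trans (lookup-∁ Z⁺ v) (cong not (insert-at Z v)))) (∧-zeroʳ _))))
      ... | no e≢v = trans (remove-other q v e e≢v) (trans (lookup-∩ (D k') (∁ Z) e) (trans
                       (cong (lookup (D k') e ∧_) (trans (lookup-∁ Z e) (trans (cong not (sym (insert-other Z v e e≢v))) (sym (lookup-∁ Z⁺ e)))))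
                       (sym (lookup-∩ (D k') (∁ Z⁺) e))))

    arcs-step : ∀ k' → arcs-from Z k' ≤ arcs-from Z⁺ k' + indicator k'
    arcs-step k' with k' ≟F v
    ... | yes refl = ≤-trans (≤-reflexive no-arcs-from-v) z≤n
    ... | no k'≢v with lookup Z k' in Zk'
    ...   | true = z≤n
    ...   | false = subst (λ b → ∣ D k' ∩ ∁ Z ∣ ≤ (if b then 0 else ∣ D k' ∩ ∁ Z⁺ ∣) + (if lookup (D k') v then 1 else 0))
                          (sym (trans (insert-other Z v k' k'≢v) Zk')) (arcs-lost k' k'≢v)

    arcs≤ : arcs Z ≤ arcs Z⁺ + c
    arcs≤ = ≤-trans (sum-mono (arcs-from Z) (λ k' → arcs-from Z⁺ k' + indicator k') arcs-step)
                    (≤-reflexive (trans (sum-+ (arcs-from Z⁺) indicator) (cong (arcs Z⁺ +_) (sym c≡))))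

    In-v : lookup In v ≡ false
    In-v = trans (In-at v) (trans (cong (not (lookup Z v) ∧_) (D-irreflexive v)) (∧-zeroʳ _))

    with-v-bound : count r (with-v Z v) * (X * 2 ^ suc c) ≤ N
    with-v-bound = subst (λ x → count r (with-v Z v) * x ≤ N) (trans (cong (λ t → 2 ^ (∣ Z ∣ + t)) (card-insert In v In-v)) (weight Z (suc c)))
      (count-constrained r (with-v Z v) Z (insert In v) λ I h → let ((avoids , closed) , Iv) = with-v-sound Z v I h in
        avoids , insert-⊑ In I v Iv (λ k' In-k' → closed k' v (∧-conicalʳ (not (lookup Z k')) _ (trans (sym (In-at k')) In-k')) Iv))

    good-for-Z⁺ : ∀ I → without-v Z v I ≡ true → good Z⁺ I ≡ true
    good-for-Z⁺ I h with without-v-sound Z v I h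
    ... | (avoids , closed) , Iv = good-complete Z⁺ I (avoids⁺ , closed)
      where
      avoids⁺ : Avoids Z⁺ I
      avoids⁺ e Z⁺e with insert-mem Z v e Z⁺e
      ... | inj₁ refl = Iv
      ... | inj₂ Ze = avoids e Ze

    without-v-bound : ClosedBound Z⁺ → Bound (count r (without-v Z v)) (arcs Z⁺) (2 * X) N
    without-v-bound IH = bound-count-mono (count r (without-v Z v)) (count r (good Z⁺)) (arcs Z⁺) (2 * X) N
                 (count-mono r (without-v Z v) (good Z⁺) good-for-Z⁺)
                 (subst (λ x → Bound (count r (good Z⁺)) (arcs Z⁺) x N) (cong (2 ^_) (card-insert Z v Zv)) IH)

    bound-sink-step : ClosedBound Z⁺ → ClosedBound Z
    bound-sink-step IH =
      split-at Z v (arcs Z) X N (bound-sink (count r (with-v Z v)) (count r (without-v Z v)) X N (arcs Z) (arcs Z⁺) c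
                                            1≤c c≤arcs arcs≤ with-v-bound (without-v-bound IH))

  closed-bound-avoiding : ∀ f Z → ∣ ∁ Z ∣ ≤ f → ClosedBound Z
  closed-bound-avoiding f Z fuel
    with any? (λ k → any? (λ v → (lookup Z k ≟B false) ×-dec (lookup (D k) v ≟B true) ×-dec (lookup Z v ≟B false)))
  ... | no no-arc = bound-without-arcs Z (λ k v Zk Dkv Zv → no-arc (k , v , Zk , Dkv , Zv))
  ... | yes (k , v , Zk , Dkv , Zv) with any? (λ u → (lookup (D v) u ≟B true) ×-dec (lookup Z u ≟B false))
  ...   | yes (u , Dvu , Zu) = bound-path Z k v u Zk Dkv Zv Dvu Zu
  ...   | no no-out = Sink.bound-sink-step Z k v Zk Dkv Zv (λ u Dvu Zu → no-out (u , Dvu , Zu)) (smaller f fuel)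
    where
    smaller : ∀ f → ∣ ∁ Z ∣ ≤ f → ClosedBound (insert Z v)
    smaller zero b = ⊥-elim (<⇒≱ (subst (0 <_) (sym (card-∁-insert Z v Zv)) (s≤s z≤n)) b)
    smaller (suc f) b = closed-bound-avoiding f (insert Z v) (≤-pred (subst (_≤ suc f) (card-∁-insert Z v Zv) b))

  closed-bound : Bound (count r (good ∅)) (sum (tabulate (λ k → ∣ D k ∣))) 1 (2 ^ r)
  closed-bound = subst₂ (λ s X → Bound (count r (good ∅)) s X (2 ^ r)) arcs-∅ (cong (2 ^_) ∣∅∣)
                        (closed-bound-avoiding r ∅ (∣p∣≤n (∁ ∅)))
    where
    arcs-∅ : arcs ∅ ≡ sum (tabulate (λ k → ∣ D k ∣))
    arcs-∅ = sum-ext (arcs-from ∅) (λ k → ∣ D k ∣) λ k →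
      trans (cong (λ b → if b then 0 else ∣ D k ∩ ∁ ∅ ∣) (lookup-∅ k))
            (card-ext (D k ∩ ∁ ∅) (D k) λ e → trans (lookup-∩ (D k) (∁ ∅) e)
              (trans (cong (lookup (D k) e ∧_) (trans (lookup-∁ ∅ e) (cong not (lookup-∅ e)))) (∧-identityʳ _)))

module UpperBound {r n : ℕ} (A : SetSystem r n) where
  open Extensions A
  open Digraph A
  open ClosedSets D D-irreflexive

  inL : Subset r → Bool
  inL I = does (InL? I)

  L-list : List (Subset r)
  L-list = enumerate r inL

  L-list-sound : ∀ I → I ∈ˡ L-list → InL A I
  L-list-sound I m = does-true (InL? I) (enumerate-sound r inL I m)

  L-list-complete : ∀ I → InL A I → I ∈ˡ L-list
  L-list-complete I L = enumerate-complete r inL I (does-intro (InL? I) L)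

  L-card : CardL A (length L-list)
  L-card = L-list , refl , enumerate-unique r inL , λ I → mk⇔ (L-list-sound I) (L-list-complete I)

  T-card : CardT A (length L-list)
  T-card = L-list , refl , pairwise-distinct L-list (enumerate-unique r inL) L-list-sound ,
           λ I → let (J , LJ , same) = closure A I in Any.map (λ { refl → same }) (L-list-complete J LJ)
    where
    pairwise-distinct : ∀ Is → Unique Is → (∀ I → I ∈ˡ Is → InL A I) →
                        AllPairs (λ I J → ¬ SameMatroid M[ Ext A I ] M[ Ext A J ]) Is
    pairwise-distinct [] _ _ = []
    pairwise-distinct (I ∷ Is) (I∉Is ∷ u) L =
      All.tabulate (λ {J} m → distinct (L I (here refl)) (L J (there m)) (All.lookup I∉Is m)) ∷
      pairwise-distinct Is u (λ J m → L J (there m))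

  InL⇒Good : ∀ I → InL A I → Good ∅ I
  InL⇒Good I L = (λ k ∅k → ⊥-elim (true≢false (trans (sym ∅k) (lookup-∅ k)))) , closed
    where
    closed : Closed I
    closed k j Dkj Ij with InL⇒closed I L k
    ... | inj₁ Ik = Ik
    ... | inj₂ no-arc = ⊥-elim (true≢false (trans (sym Dkj) (no-arc j Ij)))

  arcs-D : ℕ
  arcs-D = sum (tabulate (λ k → ∣ D k ∣))

  L-bound : Bound (length L-list) arcs-D 1 (2 ^ r)
  L-bound = bound-count-mono (length L-list) (count r (good ∅)) arcs-D 1 (2 ^ r)
    (≤-trans (≤-reflexive (length-enumerate r inL))
             (count-mono r inL (good ∅) λ I h → good-complete ∅ I (InL⇒Good I (does-true (InL? I) h))))
    closed-bound

  L-bound-rank : ∀ i → PresentationRank A i → length L-list * 2 ^ (i + 1) ≤ (2 ^ i + 1) * 2 ^ r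
  L-bound-rank i rank = subst (λ t → length L-list * 2 ^ t ≤ (2 ^ i + 1) * 2 ^ r) (+-comm 1 i)
    (≤-trans (≤-reflexive (sym (*-identityʳ _)))
             (bound-antitone (length L-list) 1 (2 ^ r) i arcs-D (rank≤arcs i rank) L-bound))

  L-bound-large-rank : ∀ i → PresentationRank A i → r ≤ i → length L-list ≤ 2 ^ (r ∸ 1)
  L-bound-large-rank i rank r≤i = bound-half (length L-list) r arcs-D (≤-trans r≤i (rank≤arcs i rank)) L-bound

-- M[A] is free, the
-- presentation has rank i, and L_A contains every I with 0 ∉ I or
-- {0, …, i} ⊆ I: these are 2^m + 2^(m − i) = (1/2 + 1/2^(i+1)) 2^r sets.
module SharpExample (m i : ℕ) (1≤i : 1 ≤ i) (i≤m : i ≤ m) where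

  r : ℕ
  r = suc m

  ≤ᵇ-true : ∀ a b → (a ≤ᵇ b) ≡ true → a ≤ b
  ≤ᵇ-true a b h = ≤ᵇ⇒≤ a b (subst T (sym h) _)

  A : SetSystem r r
  A k = if toℕ k ≤ᵇ i then insert ⁅ k ⁆ zero else ⁅ k ⁆

  A-self : ∀ k → lookup (A k) k ≡ true
  A-self k with toℕ k ≤ᵇ i
  ... | true = ⊑-insert ⁅ k ⁆ zero k (∈⇒bit (x∈⁅x⁆ k))
  ... | false = ∈⇒bit (x∈⁅x⁆ k)

  A-mem : ∀ j e → lookup (A j) e ≡ true → e ≡ j ⊎ (e ≡ zero × toℕ j ≤ i)
  A-mem j e h with toℕ j ≤ᵇ i in j≤ᵇi
  ... | false = inj₁ (x∈⁅y⁆⇒x≡y j (bit⇒∈ h))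
  ... | true with insert-mem ⁅ j ⁆ zero e h
  ...   | inj₁ e≡0 = inj₂ (e≡0 , ≤ᵇ-true (toℕ j) i j≤ᵇi)
  ...   | inj₂ h' = inj₁ (x∈⁅y⁆⇒x≡y j (bit⇒∈ h'))

  A-other : ∀ k j → j ≢ zero → j ≢ k → lookup (A k) j ≡ false
  A-other k j j≢0 j≢k = not-true λ akj → case (A-mem k j akj)
    where
    case : j ≡ k ⊎ (j ≡ zero × toℕ k ≤ i) → ⊥
    case (inj₁ j≡k) = j≢k j≡k
    case (inj₂ (j≡0 , _)) = j≢0 j≡0

  A-zero : ∀ k → k ≢ zero → ¬ toℕ k ≤ i → lookup (A k) zero ≡ false
  A-zero k k≢0 k>i = not-true λ ak0 → case (A-mem k zero ak0)
    where
    case : zero ≡ k ⊎ (zero ≡ zero × toℕ k ≤ i) → ⊥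
    case (inj₁ 0≡k) = k≢0 (sym 0≡k)
    case (inj₂ (_ , k≤i)) = k>i k≤i

  free : ∀ X → Indep A X
  free X = just , ((λ { e j refl → A-self e }) , (λ { e e' j refl refl → refl })) , (λ e _ → e , refl)

  rank-free : ∀ Y → RankOf M[ A ] Y ∣ Y ∣
  rank-free Y = (Y , Indep⇒PT A (free Y) , (λ x → x) , refl) , (λ C _ CY → p⊆q⇒∣p∣≤∣q∣ {p = C} {q = Y} CY)

  has-rank : HasRank M[ A ] r
  has-rank = subst (RankOf M[ A ] (Full r)) (∣Full∣ r) (rank-free (Full r))

  low : Fin r → ℕ
  low zero = 0
  low (suc k) = if suc (toℕ k) ≤ᵇ i then 1 else 0

  ∣A∣ : ∀ k → ∣ A k ∣ ≡ suc (low k)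
  ∣A∣ zero = trans (card-ext (insert ⁅ zero ⁆ zero) ⁅ zero ⁆ same) (∣⁅x⁆∣≡1 {n = r} zero)
    where
    same : ∀ e → lookup (insert ⁅ zero ⁆ zero) e ≡ lookup ⁅ zero {m} ⁆ e
    same zero = insert-at ⁅ zero ⁆ zero
    same (suc e) = insert-other ⁅ zero ⁆ zero (suc e) (λ ())
  ∣A∣ (suc k) with suc (toℕ k) ≤ᵇ i
  ... | true = trans (card-insert ⁅ suc k ⁆ zero refl) (cong suc (∣⁅x⁆∣≡1 (suc k)))
  ... | false = ∣⁅x⁆∣≡1 (suc k)

  Σlow : sum (tabulate low) ≡ i
  Σlow = first-i m i i≤m
    where
    first-i : ∀ m' i' → i' ≤ m' → sum (tabulate {n = m'} (λ k → if suc (toℕ k) ≤ᵇ i' then 1 else 0)) ≡ i'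
    first-i m' zero _ = sum-zero {m'} _ (λ k → refl)
    first-i (suc m') (suc i') (s≤s le) = cong suc (first-i m' i' le)

  -- r(M \ A_k) + low k = r − 1, so Σ_k r(M \ A_k) = r(r − 1) − i.
  presentation-rank : PresentationRank A i
  presentation-rank = ks , (λ k → rank-free (∁ (A k))) , total
    where
    ks : Fin r → ℕ
    ks k = ∣ ∁ (A k) ∣
    low≤1 : ∀ k → low k ≤ 1
    low≤1 zero = z≤n
    low≤1 (suc k) with suc (toℕ k) ≤ᵇ i
    ... | true = ≤-refl
    ... | false = z≤n
    ks+low : ∀ k → ks k + low k ≡ m
    ks+low k = trans (cong (_+ low k) (trans (∣∁p∣≡n∸∣p∣ (A k)) (cong (r ∸_) (∣A∣ k))))
                     (m∸n+n≡m (≤-trans (low≤1 k) (≤-trans 1≤i i≤m)))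
    total : i + sum (tabulate ks) ≡ r * (r ∸ 1)
    total = begin
      i + sum (tabulate ks)                 ≡⟨ cong (_+ sum (tabulate ks)) (sym Σlow) ⟩
      sum (tabulate low) + sum (tabulate ks) ≡⟨ +-comm (sum (tabulate low)) _ ⟩
      sum (tabulate ks) + sum (tabulate low) ≡⟨ sum-+ ks low ⟨
      sum (tabulate (λ k → ks k + low k))   ≡⟨ sum-ext _ (λ _ → m) ks+low ⟩
      sum (tabulate {n = r} (λ _ → m))      ≡⟨ sum-const r m ⟩
      r * m                                 ∎
      where open ≡-Reasoning

  first-bits : ∀ {m'} → ℕ → Vec Bool m' → Bool
  first-bits zero v = true
  first-bits (suc i') [] = true
  first-bits (suc i') (b ∷ v) = b ∧ first-bits i' v

  first-bits-lookup : ∀ {m'} i' (v : Vec Bool m') k → first-bits i' v ≡ true → suc (toℕ k) ≤ i' → lookup v k ≡ true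
  first-bits-lookup (suc i') (b ∷ v) zero h _ = ∧-conicalˡ b _ h
  first-bits-lookup (suc i') (b ∷ v) (suc k) h (s≤s le) = first-bits-lookup i' v k (∧-conicalʳ b _ h) le

  count-first-bits : ∀ m' i' → i' ≤ m' → count m' (first-bits i') ≡ 2 ^ (m' ∸ i')
  count-first-bits m' zero _ = count-all m'
  count-first-bits (suc m') (suc i') (s≤s le) =
    trans (cong (_+ count m' (first-bits i')) (count-none m' (λ _ → false) (λ _ ()))) (count-first-bits m' i' le)

  -- The sets 0 ∉ I or {0, …, i} ⊆ I.
  sharp : Subset r → Bool
  sharp (b ∷ v) = not b ∨ first-bits i v

  sharp-sem : ∀ I → sharp I ≡ true → lookup I zero ≡ true → ∀ k → toℕ k ≤ i → lookup I k ≡ true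
  sharp-sem (true ∷ v) _ I0 zero _ = I0
  sharp-sem (true ∷ v) h _ (suc k) k≤i = first-bits-lookup i v k h k≤i

  count-sharp : count r sharp ≡ 2 ^ m + 2 ^ (m ∸ i)
  count-sharp = cong₂ _+_ (count-all m) (count-first-bits m i i≤m)

  -- Each e ∉ A_k with e ≠ 0 must use its own
  -- set A_e, so x can only use A_0; then 0 ∈ I, so toℕ k > i and 0 ∉ A_k,
  -- and the element 0 needs some A_j with 1 ≤ j ≤ i, already used by j.
  module NoRoom (I : Subset r) (k : Fin r) (Ik : lookup I k ≡ false) (sharp-I : sharp I ≡ true)
                (C : Subset (suc r)) (m : Matching r (suc r)) (m-matching : IsMatching (Ext A I) m) (m-covers : Covers m C)
                (outside⊆C : ∀ e → lookup (A k) e ≡ false → lookup C (suc e) ≡ true) where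

    own-set : ∀ e → e ≢ zero → lookup (A k) e ≡ false → m (suc e) ≡ just e
    own-set e e≢0 ake with m-covers (suc e) (outside⊆C e ake)
    ... | j , me with A-mem j e (proj₁ m-matching (suc e) j me)
    ...   | inj₁ refl = me
    ...   | inj₂ (e≡0 , _) = ⊥-elim (e≢0 e≡0)

    taken : ∀ e j → j ≢ zero → j ≢ k → m e ≡ just j → e ≡ suc j
    taken e j j≢0 j≢k me = proj₂ m-matching e (suc j) j me (own-set j j≢0 (A-other k j j≢0 j≢k))

    zero-placed : m zero ≡ just zero → ⊥
    zero-placed mx = element-0 (m-covers (suc zero) (outside⊆C zero (A-zero k k≢0 k>i)))
      where
      I0 : lookup I zero ≡ true
      I0 = proj₁ m-matching zero zero mx
      k≢0 : k ≢ zero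
      k≢0 refl = true≢false (trans (sym I0) Ik)
      k>i : ¬ toℕ k ≤ i
      k>i k≤i = true≢false (trans (sym (sharp-sem I sharp-I I0 k k≤i)) Ik)
      element-0 : Σ (Fin r) (λ j → m (suc zero) ≡ just j) → ⊥
      element-0 (j , m0) with j ≟F zero | A-mem j zero (proj₁ m-matching (suc zero) j m0)
      ... | yes refl | _ = zero≢suc (proj₂ m-matching zero (suc zero) zero mx m0)
      element-0 (j , m0) | no j≢0 | inj₁ 0≡j = j≢0 (sym 0≡j)
      element-0 (j , m0) | no j≢0 | inj₂ (_ , j≤i) = j≢0 (sym (suc-injective (taken (suc zero) j j≢0 j≢k m0)))
        where
        j≢k : j ≢ k
        j≢k refl = k>i j≤i

    no-x : lookup C zero ≡ true → ⊥
    no-x C0 with m-covers zero C0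
    ... | j , mx with j ≟F zero
    ...   | yes refl = zero-placed mx
    ...   | no j≢0 = zero≢suc (taken zero j j≢0 j≢k mx)
      where
      j≢k : j ≢ k
      j≢k refl = true≢false (trans (sym (proj₁ m-matching zero k mx)) Ik)

  -- Sharp sets are fixed points of σ: for k ∉ I, the basis E − A_k of
  -- M[A^I] \ A_k avoids x.
  sharp⇒InL : ∀ I → sharp I ≡ true → InL A I
  sharp⇒InL I sharp-I k k∉I coloop = true≢false (sym (∈⇒bit (proj₂ coloop B (Basis⇒IsBasisOf (Ext A I) basis))))
    where
    Ik : lookup I k ≡ false
    Ik = not-true (k∉I ∘ bit⇒∈)
    B : Subset (suc r)
    B = false ∷ ∁ (A k)
    own : Matching r (suc r)
    own zero = nothing
    own (suc e) = just e
    own-matching : IsMatching (Ext A I) own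
    own-matching = (λ { (suc e) j refl → A-self e }) , (λ { (suc e) (suc e') j refl refl → refl })
    basis : Basis (Ext A I) (Extensions.Outside A k) B
    basis = (own , own-matching , λ { (suc e) _ → e , refl }) , (λ { (suc e) h → h }) , maximal
      where
      maximal : ∀ C → Indep (Ext A I) C → B ⊑ C → C ⊑ Extensions.Outside A k → C ⊑ B
      maximal C iC B⊑C C⊑Y zero C0 =
        ⊥-elim (NoRoom.no-x I k Ik sharp-I C (proj₁ iC) (proj₁ (proj₂ iC)) (proj₂ (proj₂ iC))
                  (λ e ake → B⊑C (suc e) (trans (lookup-∁ (A k) e) (cong not ake))) C0)
      maximal C iC B⊑C C⊑Y (suc e) Ce = C⊑Y (suc e) Ce

  attains-bound : length (UpperBound.L-list A) * 2 ^ (i + 1) ≡ (2 ^ i + 1) * 2 ^ r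
  attains-bound = ≤-antisym (UpperBound.L-bound-rank A i presentation-rank)
    (≤-trans (≤-reflexive (sym exact)) (*-monoˡ-≤ (2 ^ (i + 1)) at-least))
    where
    open UpperBound A using (L-list; inL)
    at-least : 2 ^ m + 2 ^ (m ∸ i) ≤ length L-list
    at-least = ≤-trans (≤-reflexive (sym count-sharp))
      (≤-trans (count-mono r sharp inL (λ I h → does-intro (Extensions.InL? A I) (sharp⇒InL I h)))
               (≤-reflexive (sym (length-enumerate r inL))))
    regroup : ∀ D P → (D * P + D) * (P * (2 * 1)) ≡ (P + 1) * (2 * (D * P))
    regroup = solve-∀
    exact : (2 ^ m + 2 ^ (m ∸ i)) * 2 ^ (i + 1) ≡ (2 ^ i + 1) * 2 ^ r
    exact = subst (λ x → (2 ^ x + 2 ^ (x ∸ i)) * 2 ^ (i + 1) ≡ (2 ^ i + 1) * 2 ^ suc x) (m∸n+n≡m i≤m)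
      (trans (cong (λ y → (2 ^ (m ∸ i + i) + 2 ^ y) * 2 ^ (i + 1)) (m+n∸n≡m (m ∸ i) i))
      (trans (cong₂ (λ a b → (a + 2 ^ (m ∸ i)) * b) (^-distribˡ-+-* 2 (m ∸ i) i) (^-distribˡ-+-* 2 i 1))
      (trans (regroup (2 ^ (m ∸ i)) (2 ^ i))
      (cong (λ z → (2 ^ i + 1) * (2 * z)) (sym (^-distribˡ-+-* 2 (m ∸ i) i))))))

theorem4p1 :
    ((r n i : ℕ) (A : SetSystem r n) → HasRank M[ A ] r → PresentationRank A i →
        1 ≤ i → i < r →
        Σ ℕ λ t → Σ ℕ λ l → CardT A t × CardL A l × t ≡ l ×
          l * 2 ^ (i + 1) ≤ (2 ^ i + 1) * 2 ^ r)
    × ((r i : ℕ) → 1 ≤ i → i < r →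
        Σ ℕ λ n → Σ (SetSystem r n) λ A → HasRank M[ A ] r × PresentationRank A i ×
          Σ ℕ λ t → CardT A t × CardL A t × t * 2 ^ (i + 1) ≡ (2 ^ i + 1) * 2 ^ r)
    × ((r n i : ℕ) (A : SetSystem r n) → HasRank M[ A ] r → PresentationRank A i →
        r ≤ i →
        Σ ℕ λ t → Σ ℕ λ l → CardT A t × CardL A l × t ≡ l × l ≤ 2 ^ (r ∸ 1))
theorem4p1 =
  (λ r n i A _ rank _ _ → let open UpperBound A in
     length L-list , length L-list , T-card , L-card , refl , L-bound-rank i rank) ,
  (λ { zero i _ ()
     ; (suc m) i 1≤i (s≤s i≤m) → let open SharpExample m i 1≤i i≤m in
         r , A , has-rank , presentation-rank ,
         length (UpperBound.L-list A) , UpperBound.T-card A , UpperBound.L-card A , attains-bound }) ,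
  (λ r n i A _ rank r≤i → let open UpperBound A in
     length L-list , length L-list , T-card , L-card , refl , L-bound-large-rank i rank r≤i)
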